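{- Let $\mathcal{T}(m)$ denote the number of iterations of the Pisano period $\pi$ applied to $m$ until the trajectory of $m$ reaches a fixed point. Then $\limsup_{m\to\infty} \frac{\mathcal{T}(m)}{\log m} < \infty$.
   Context: The Fibonacci sequence is $F_0=0$, $F_1=1$, $F_n=F_{n-1}+F_{n-2}$. For an integer $m>1$, $\pi(m)$ (the Pisano period) is the length of the shortest period of the Fibonacci sequence modulo $m$; iterates are $\pi^{i+1}(m)=\pi(\pi^i(m))$. A fixed point is an integer $m>1$ with $\pi(m)=m$; every trajectory $m,\pi(m),\pi^2(m),\dots$ of an integer $m>1$ eventually reaches a fixed point, and $\mathcal{T}(m)$ is the least $j\ge0$ such that $\pi^j(m)$ is a fixed point (e.g. $\mathcal{T}(2)=4$, $\mathcal{T}(24)=0$). -}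

module Defs where

open import Data.Nat using (ℕ; zero; suc; _+_; _*_; _%_; _<_; _≡ᵇ_)
open import Data.Bool using (Bool; true; false; if_then_else_; _∧_)
open import Data.Product using (_×_)
open import Relation.Binary.PropositionalEquality using (_≡_)
open import Relation.Nullary using (¬_)

fib : ℕ → ℕ
fib zero = zero
fib (suc zero) = suc zero
fib (suc (suc n)) = fib (suc n) + fib n

isPeriod : ℕ → ℕ → Bool
isPeriod zero k = false
isPeriod (suc n) k = ((fib k % suc n) ≡ᵇ 0) ∧ ((fib (suc k) % suc n) ≡ᵇ (1 % suc n))

-- first P k f : least i ∈ [k, k+f) with P i = true (0 if none)
first : (ℕ → Bool) → ℕ → ℕ → ℕ
first P k zero = zero
first P k (suc f) = if P k then k else first P (suc k) f

-- Pisano period: least k ≥ 1 with isPeriod m k.  For m > 1 such a k exists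
-- and satisfies k ≤ m * m (pigeonhole on pairs mod m), so the bounded search
-- over [1, m*m] returns exactly π(m).
pisano : ℕ → ℕ
pisano m = first (isPeriod m) 1 (m * m)

pisanoIter : ℕ → ℕ → ℕ
pisanoIter zero m = m
pisanoIter (suc j) m = pisano (pisanoIter j m)

IsFixed : ℕ → Set
IsFixed m = (1 < m) × (pisano m ≡ m)

IsT : ℕ → ℕ → Set
IsT m j = IsFixed (pisanoIter j m) × (∀ i → i < j → ¬ IsFixed (pisanoIter i m))

-- Since π (lcm a b) = lcm (π a) (π b), the trajectory of m is the lcm of the trajectories of
-- its prime-power factors, and it suffices to show, by strong induction, that every q reaches a
-- fixed point after some j steps with 2 ^ j ≤ 64 q².  Lifting periods gives
-- π (p ^ (e + 1)) ∣ p ^ e · π p.  Divisors of 2 ^ g are fixed after g + 4 steps because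
-- π (2 ^ (g + 1)) ∣ 3 · 2 ^ g, and 5 ^ (e + 1) reaches the fixed point 24 · 5 ^ (e + 1) in three
-- steps because π (5 ^ (e + 1)) = 4 · 5 ^ (e + 1).  For every other prime p the Frobenius map of
-- ℤ[√5]/p gives π p ∣ p − 1 or π p ∣ 2 (p + 1), so π (p ^ (e + 1)) is the lcm of a divisor of
-- p ^ e, a power of 2 at most 2 (p + 1) and an odd number at most (p + 1) / 2.  Each part is
-- fixed within the budget 32 p ^ (2e + 2), by induction or by the bound for powers of 2, and the
-- step from p ^ (e + 1) to its Pisano period doubles the budget.  Finally 2 ^ j ≤ 64 m² gives
-- j ≤ 10 ⌊log₂ m⌋.

module Submission where

open import Defs

open import Data.Nat using (ℕ; zero; suc; _≤_; _<_; z≤n; s≤s; NonZero)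
import Data.Nat as Nat
import Data.Nat.Properties as ℕₚ
open import Data.Nat.DivMod using (m≡m%n+[m/n]*n; m%n<n; %-remove-+ʳ)
import Data.Nat.DivMod as DivMod
open import Data.Nat.Divisibility using (divides) renaming (_∣_ to _∣ℕ_)
import Data.Nat.Divisibility as ℕ∣
import Data.Nat.Coprimality as Coprimality
open import Data.Nat.Primality
  using (Prime; prime?; euclidsLemma; prime⇒nonZero; prime⇒irreducible; prime⇒nonTrivial; ¬prime[1]; prime[2])
open import Relation.Nullary.Decidable using (from-yes; from-no)
open import Data.Nat.LCM using (lcm; lcm-least)
open import Data.Integer using (ℤ; +_; 0ℤ; 1ℤ)
import Data.Integer as Int
import Data.Integer.Properties as ℤₚ
import Data.Integer.Divisibility.Signed as ℤ∣
open import Data.Integer.DivMod using (a≡a%ℕn+[a/ℕn]*n)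
open import Data.Bool using (Bool; true; false; T)
open import Data.Bool.Properties using (T-∧)
open import Function.Base using (_∘_)
open import Function.Bundles using (Equivalence)
open import Data.Product using (Σ; ∃; _×_; _,_; proj₁; proj₂)
open import Data.Sum using (_⊎_; inj₁; inj₂; reduce)
open import Data.Empty using (⊥-elim)
open import Data.Fin using (Fin)
import Data.Fin as Fin
import Data.Fin.Properties as Fin
open import Relation.Nullary using (¬_; yes; no)
open import Relation.Binary.Bundles using (Setoid)
open import Relation.Binary.Structures using (IsEquivalence)
open import Algebra.Structures using (IsCommutativeMonoid)
open import Algebra.Bundles using (CommutativeSemiring)
open import Relation.Binary.PropositionalEquality
  using (_≡_; _≢_; refl; sym; trans; cong; cong₂; subst; subst₂; module ≡-Reasoning)

module _ where
  open Nat using (_*_; _^_)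
  open import Data.Nat.Coprimality using (Coprime; coprime-divisor; coprime⇒gcd≡1)
  open import Data.Nat.GCD
    using (gcd; gcd[m,n]∣m; gcd[m,n]∣n; gcd[m,n]≢0; gcd-greatest; c*gcd[m,n]≡gcd[cm,cn]; gcd-comm)
  open import Data.Nat.LCM using (gcd*lcm; m∣lcm[m,n]; n∣lcm[m,n])
  open import Data.Nat.Primality.Factorisation using (factorise)
  open import Data.Nat.Induction using (<-rec)
  open import Data.Nat.ListAction using (product)
  open import Data.List using ([]; _∷_)
  open import Data.List.Relation.Unary.All using (_∷_)

  prime[3] : Prime 3
  prime[3] = from-yes (prime? 3)

  prime[5] : Prime 5
  prime[5] = from-yes (prime? 5)

  prime>1 : ∀ {p} → Prime p → 1 < p
  prime>1 {p} p-prime = Nat.nonTrivial⇒n>1 p {{prime⇒nonTrivial p-prime}}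

  odd-prime-≥3 : ∀ {p} → Prime p → p ≢ 2 → 3 ≤ p
  odd-prime-≥3 p-prime p≢2 with ℕₚ.m≤n⇒m<n∨m≡n (prime>1 p-prime)
  ... | inj₁ 2<p = 2<p
  ... | inj₂ 2≡p = ⊥-elim (p≢2 (sym 2≡p))

  gcd-positive : ∀ {y} x → 1 ≤ y → 1 ≤ gcd y x
  gcd-positive {y} x 1≤y = ℕₚ.n≢0⇒n>0 (gcd[m,n]≢0 y x (inj₁ (ℕₚ.m<n⇒n≢0 1≤y)))

  coprime-*ˡ : ∀ {a b c} → Coprime a c → Coprime b c → Coprime (a * b) c
  coprime-*ˡ {a} a⊥c b⊥c {i} (i∣ab , i∣c) = b⊥c (coprime-divisor i⊥a i∣ab , i∣c)
    where
    i⊥a : Coprime i a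
    i⊥a (j∣i , j∣a) = a⊥c (j∣a , ℕ∣.∣-trans j∣i i∣c)

  prime^-coprime : ∀ {q b} → Prime q → ¬ q ∣ℕ b → ∀ e → Coprime (q ^ e) b
  prime^-coprime q-prime q∤b zero    (i∣1 , _) = ℕ∣.∣1⇒≡1 i∣1
  prime^-coprime {q} {b} q-prime q∤b (suc e) = coprime-*ˡ q⊥b (prime^-coprime q-prime q∤b e)
    where
    q⊥b : Coprime q b
    q⊥b (i∣q , i∣b) with prime⇒irreducible q-prime i∣q
    ... | inj₁ i≡1  = i≡1
    ... | inj₂ refl = ⊥-elim (q∤b i∣b)

  coprime⇒lcm≡* : ∀ {a b} → Coprime a b → lcm a b ≡ a * b
  coprime⇒lcm≡* {a} {b} a⊥b =
    trans (sym (ℕₚ.*-identityˡ (lcm a b))) (trans (cong (_* lcm a b) (sym (coprime⇒gcd≡1 a⊥b))) (gcd*lcm a b))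

  lcm-assoc : ∀ a b c → lcm (lcm a b) c ≡ lcm a (lcm b c)
  lcm-assoc a b c = ℕ∣.∣-antisym
    (lcm-least (lcm-least a∣rhs (ℕ∣.∣-trans (m∣lcm[m,n] b c) bc∣rhs)) (ℕ∣.∣-trans (n∣lcm[m,n] b c) bc∣rhs))
    (lcm-least (ℕ∣.∣-trans (m∣lcm[m,n] a b) ab∣lhs)
               (lcm-least (ℕ∣.∣-trans (n∣lcm[m,n] a b) ab∣lhs) (n∣lcm[m,n] (lcm a b) c)))
    where
    a∣rhs = m∣lcm[m,n] a (lcm b c)
    bc∣rhs = n∣lcm[m,n] a (lcm b c)
    ab∣lhs = m∣lcm[m,n] (lcm a b) c

  ∣coprime-*⇒≡lcm-gcd : ∀ {a b y} → Coprime a b → y ∣ℕ a * b → y ≡ lcm (gcd y a) (gcd y b)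
  ∣coprime-*⇒≡lcm-gcd {a} {b} {y} a⊥b y∣ab =
    ℕ∣.∣-antisym y∣lcm (lcm-least (gcd[m,n]∣m y a) (gcd[m,n]∣m y b))
    where
    u = gcd y a
    w = gcd y b
    y∣b*u : y ∣ℕ b * u
    y∣b*u = subst (y ∣ℕ_) (trans (sym (c*gcd[m,n]≡gcd[cm,cn] b a y)) (cong (b *_) (gcd-comm a y)))
                  (gcd-greatest (subst (y ∣ℕ_) (ℕₚ.*-comm a b) y∣ab) (ℕ∣.n∣m*n b))
    y∣u*w : y ∣ℕ u * w
    y∣u*w = subst (y ∣ℕ_) (trans (sym (c*gcd[m,n]≡gcd[cm,cn] u b y)) (cong (u *_) (gcd-comm b y)))
                  (gcd-greatest (subst (y ∣ℕ_) (ℕₚ.*-comm b u) y∣b*u) (ℕ∣.n∣m*n u))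
    u⊥w : Coprime u w
    u⊥w (i∣u , i∣w) = a⊥b (ℕ∣.∣-trans i∣u (gcd[m,n]∣n y a) , ℕ∣.∣-trans i∣w (gcd[m,n]∣n y b))
    y∣lcm : y ∣ℕ lcm u w
    y∣lcm = subst (y ∣ℕ_) (sym (coprime⇒lcm≡* u⊥w)) y∣u*w

  prime-divisor : ∀ {m} → 2 ≤ m → ∃ λ p → Prime p × p ∣ℕ m
  prime-divisor {m@(suc _)} 2≤m with factorise m
  ... | record { factors = [] ; isFactorisation = m≡1 } = ⊥-elim (ℕₚ.<-irrefl (sym m≡1) 2≤m)
  ... | record { factors = p ∷ ps ; isFactorisation = m≡p*ps ; factorsPrime = p-prime ∷ _ } =
    p , p-prime , divides (product ps) (trans m≡p*ps (ℕₚ.*-comm p (product ps)))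

  factor-out : ∀ {p} → Prime p → ∀ m → 1 ≤ m → ∃ λ e → ∃ λ r → m ≡ p ^ e * r × ¬ p ∣ℕ r
  factor-out {p} p-prime = <-rec _ go
    where
    go : ∀ m → (∀ {k} → k < m → 1 ≤ k → ∃ λ e → ∃ λ r → k ≡ p ^ e * r × ¬ p ∣ℕ r) →
         1 ≤ m → ∃ λ e → ∃ λ r → m ≡ p ^ e * r × ¬ p ∣ℕ r
    go m rec 1≤m with p ℕ∣.∣? m
    ... | no p∤m = 0 , m , sym (ℕₚ.+-identityʳ m) , p∤m
    ... | yes (divides k refl) with rec {k} k<k*p 1≤k
      where
      instance
        k≢0 : NonZero k
        k≢0 = ℕₚ.m*n≢0⇒m≢0 k {{Nat.>-nonZero 1≤m}}
      1≤k : 1 ≤ k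
      1≤k = Nat.>-nonZero⁻¹ k
      k<k*p : k < k * p
      k<k*p = ℕₚ.m<m*n k p (prime>1 p-prime)
    ...   | e , r , k≡p^e*r , p∤r =
      suc e , r , trans (cong (_* p) k≡p^e*r) (trans (ℕₚ.*-comm _ p) (sym (ℕₚ.*-assoc p (p ^ e) r))) , p∤r

module _ where
  open Nat using (_+_; _*_)
  open import Data.Nat.Tactic.RingSolver using (solve-∀)

  square-mono : ∀ {a b} → a ≤ b → a * a ≤ b * b
  square-mono a≤b = ℕₚ.*-mono-≤ a≤b a≤b

  1+p≤p*p : ∀ {p} → 2 ≤ p → suc p ≤ p * p
  1+p≤p*p {suc (suc d)} (s≤s (s≤s z≤n)) =
    ℕₚ.≤-trans (ℕₚ.m≤m+n _ (d * d + 3 * d + 1)) (ℕₚ.≤-reflexive (expand d))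
    where
    expand : ∀ d → 3 + d + (d * d + 3 * d + 1) ≡ (2 + d) * (2 + d)
    expand = solve-∀

  2c≤1+p⇒c<p : ∀ {c p} → 2 ≤ p → 2 * c ≤ suc p → c < p
  2c≤1+p⇒c<p {c} {p} 2≤p 2c≤p+1 = ℕₚ.*-cancelˡ-< 2 c p (begin-strict
    2 * c        ≤⟨ 2c≤p+1 ⟩
    suc p        <⟨ ℕₚ.n<1+n (suc p) ⟩
    2 + p        ≤⟨ ℕₚ.+-monoˡ-≤ p 2≤p ⟩
    p + p        ≡⟨ cong (_+_ p) (ℕₚ.+-identityʳ p) ⟨
    2 * p        ∎)
    where open ℕₚ.≤-Reasoning

  u≤t⇒2u²≤[pt]² : ∀ {u t p} → u ≤ t → 2 ≤ p → 2 * (u * u) ≤ (p * t) * (p * t)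
  u≤t⇒2u²≤[pt]² {u} {t} {p} u≤t 2≤p =
    ℕₚ.≤-trans (ℕₚ.*-mono-≤ 2≤p² (square-mono u≤t)) (ℕₚ.≤-reflexive (regroup p t))
    where
    2≤p² : 2 ≤ p * p
    2≤p² = ℕₚ.≤-trans 2≤p (ℕₚ.≤-trans (ℕₚ.n≤1+n p) (1+p≤p*p 2≤p))
    regroup : ∀ p t → p * p * (t * t) ≡ (p * t) * (p * t)
    regroup = solve-∀

  2c≤1+p⇒2c²≤p² : ∀ {c p} → 3 ≤ p → 2 * c ≤ suc p → 2 * (c * c) ≤ p * p
  2c≤1+p⇒2c²≤p² {c} {suc (suc (suc d))} (s≤s (s≤s (s≤s z≤n))) 2c≤p+1 = ℕₚ.*-cancelˡ-≤ 4 (begin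
    4 * (2 * (c * c))        ≡⟨ regroup c ⟩
    2 * ((2 * c) * (2 * c))  ≤⟨ ℕₚ.*-monoʳ-≤ 2 (square-mono 2c≤p+1) ⟩
    2 * ((4 + d) * (4 + d))  ≤⟨ ℕₚ.m≤m+n _ (2 * (d * d) + 8 * d + 4) ⟩
    2 * ((4 + d) * (4 + d)) + (2 * (d * d) + 8 * d + 4) ≡⟨ expand d ⟩
    4 * ((3 + d) * (3 + d))  ∎)
    where
    open ℕₚ.≤-Reasoning
    regroup : ∀ c → 4 * (2 * (c * c)) ≡ 2 * ((2 * c) * (2 * c))
    regroup = solve-∀
    expand : ∀ d → 2 * ((4 + d) * (4 + d)) + (2 * (d * d) + 8 * d + 4) ≡ 4 * ((3 + d) * (3 + d))
    expand = solve-∀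

  even-or-odd : ∀ n → ∃ λ k → n ≡ k + k ⊎ n ≡ suc (k + k)
  even-or-odd zero = 0 , inj₁ refl
  even-or-odd (suc n) with even-or-odd n
  ... | k , inj₁ n≡k+k = k , inj₂ (cong suc n≡k+k)
  ... | k , inj₂ n≡1+k+k = suc k , inj₁ (cong suc (trans n≡1+k+k (sym (ℕₚ.+-suc k k))))

-- Congruences of integers
module _ where
  open Int using (_+_; _*_; _-_; -_)
  open ℤ∣ using (_∣_)
  open import Data.Integer.Tactic.RingSolver using (solve-∀)

  infix 4 _≡_mod_
  record _≡_mod_ (x y : ℤ) (m : ℕ) : Set where
    constructor mkMod
    field
      +m∣x-y : + m ∣ x - y

  private
    ∣-subst : ∀ {k a b} → a ≡ b → k ∣ a → k ∣ b
    ∣-subst refl k∣a = k∣a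

  ≡⇒≡mod : ∀ {m x y} → x ≡ y → x ≡ y mod m
  ≡⇒≡mod {m} {x} refl = mkMod (ℤ∣.divides 0ℤ (x-x≡0*m x (+ m)))
    where
    x-x≡0*m : ∀ x m → x - x ≡ 0ℤ * m
    x-x≡0*m = solve-∀

  mod-sym : ∀ {m x y} → x ≡ y mod m → y ≡ x mod m
  mod-sym {x = x} {y} (mkMod m∣) = mkMod (∣-subst (-[x-y]≡y-x x y) (ℤ∣.∣m⇒∣-m m∣))
    where
    -[x-y]≡y-x : ∀ x y → - (x - y) ≡ y - x
    -[x-y]≡y-x = solve-∀

  mod-trans : ∀ {m x y z} → x ≡ y mod m → y ≡ z mod m → x ≡ z mod m
  mod-trans {x = x} {y} {z} (mkMod m∣₁) (mkMod m∣₂) =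
    mkMod (∣-subst (telescope x y z) (ℤ∣.∣m∣n⇒∣m+n m∣₁ m∣₂))
    where
    telescope : ∀ x y z → (x - y) + (y - z) ≡ x - z
    telescope = solve-∀

  mod-setoid : ℕ → Setoid _ _
  mod-setoid m = record
    { Carrier       = ℤ
    ; _≈_           = λ x y → x ≡ y mod m
    ; isEquivalence = record { refl = ≡⇒≡mod refl ; sym = mod-sym ; trans = mod-trans }
    }

  +-cong-mod : ∀ {m a b c d} → a ≡ b mod m → c ≡ d mod m → a + c ≡ b + d mod m
  +-cong-mod {a = a} {b} {c} {d} (mkMod m∣₁) (mkMod m∣₂) =
    mkMod (∣-subst (regroup a b c d) (ℤ∣.∣m∣n⇒∣m+n m∣₁ m∣₂))
    where
    regroup : ∀ a b c d → (a - b) + (c - d) ≡ (a + c) - (b + d)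
    regroup = solve-∀

  neg-cong-mod : ∀ {m a b} → a ≡ b mod m → - a ≡ - b mod m
  neg-cong-mod {a = a} {b} (mkMod m∣) = mkMod (∣-subst (regroup a b) (ℤ∣.∣m⇒∣-m m∣))
    where
    regroup : ∀ a b → - (a - b) ≡ (- a) - (- b)
    regroup = solve-∀

  *-cong-mod : ∀ {m a b c d} → a ≡ b mod m → c ≡ d mod m → a * c ≡ b * d mod m
  *-cong-mod {a = a} {b} {c} {d} (mkMod m∣₁) (mkMod m∣₂) =
    mkMod (∣-subst (regroup a b c d) (ℤ∣.∣m∣n⇒∣m+n (ℤ∣.∣m⇒∣m*n c m∣₁) (ℤ∣.∣n⇒∣m*n b m∣₂)))
    where
    regroup : ∀ a b c d → (a - b) * c + b * (c - d) ≡ a * c - b * d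
    regroup = solve-∀

  mod-∣ : ∀ {d m x y} → d ∣ℕ m → x ≡ y mod m → x ≡ y mod d
  mod-∣ d∣m (mkMod m∣) = mkMod (ℤ∣.∣-trans (ℤ∣.∣ᵤ⇒∣ d∣m) m∣)

  mod-lcm : ∀ {a b x y} → x ≡ y mod a → x ≡ y mod b → x ≡ y mod lcm a b
  mod-lcm (mkMod a∣) (mkMod b∣) = mkMod (ℤ∣.∣ᵤ⇒∣ (lcm-least (ℤ∣.∣⇒∣ᵤ a∣) (ℤ∣.∣⇒∣ᵤ b∣)))

-- Periods of the Fibonacci sequence
module _ where
  open Int using (_+_; _*_; -_)
  open Nat using () renaming (_+_ to _+ℕ_; _*_ to _*ℕ_)

  F : ℕ → ℤ
  F n = + fib n

  F-rec : ∀ n → F (suc (suc n)) ≡ F (suc n) + F n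
  F-rec n = ℤₚ.pos-+ (fib (suc n)) (fib n)

  fib-shift : ∀ {m} u {a b} → F a ≡ u * F b mod m → F (suc a) ≡ u * F (suc b) mod m →
              ∀ t → F (t +ℕ a) ≡ u * F (t +ℕ b) mod m × F (suc (t +ℕ a)) ≡ u * F (suc (t +ℕ b)) mod m
  fib-shift u ≡₀ ≡₁ zero = ≡₀ , ≡₁
  fib-shift u {a} {b} ≡₀ ≡₁ (suc t) with fib-shift u ≡₀ ≡₁ t
  ... | ≡t , ≡t+1 = ≡t+1 , (begin
    F (suc (suc (t +ℕ a)))                    ≡⟨ F-rec (t +ℕ a) ⟩
    F (suc (t +ℕ a)) + F (t +ℕ a)             ≈⟨ +-cong-mod ≡t+1 ≡t ⟩
    u * F (suc (t +ℕ b)) + u * F (t +ℕ b)     ≡⟨ ℤₚ.*-distribˡ-+ u _ _ ⟨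
    u * (F (suc (t +ℕ b)) + F (t +ℕ b))       ≡⟨ cong (u *_) (F-rec (t +ℕ b)) ⟨
    u * F (suc (suc (t +ℕ b)))                ∎)
    where open import Relation.Binary.Reasoning.Setoid (mod-setoid _)

  record Period (m k : ℕ) : Set where
    constructor _,_
    field
      F≡0 : F k ≡ 0ℤ mod m
      F≡1 : F (suc k) ≡ 1ℤ mod m

  period-shift : ∀ {m a} → Period m a →
                 ∀ t → F (t +ℕ a) ≡ F t mod m × F (suc (t +ℕ a)) ≡ F (suc t) mod m
  period-shift {m} (≡₀ , ≡₁) t with fib-shift 1ℤ ≡₀ ≡₁ t
  ... | ≡t , ≡t+1 = mod-trans ≡t (≡⇒≡mod (unit t)) , mod-trans ≡t+1 (≡⇒≡mod (unit (suc t)))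
    where
    unit : ∀ n → 1ℤ * F (n +ℕ 0) ≡ F n
    unit n = trans (ℤₚ.*-identityˡ _) (cong F (ℕₚ.+-identityʳ n))

  period-0 : ∀ {m} → Period m 0
  period-0 = ≡⇒≡mod refl , ≡⇒≡mod refl

  period-+ : ∀ {m a b} → Period m a → Period m b → Period m (b +ℕ a)
  period-+ {b = b} pa (≡₀ , ≡₁) with period-shift pa b
  ... | ≡b , ≡b+1 = mod-trans ≡b ≡₀ , mod-trans ≡b+1 ≡₁

  period-∸ : ∀ {m a b} → Period m a → Period m (b +ℕ a) → Period m b
  period-∸ {b = b} pa (≡₀ , ≡₁) with period-shift pa b
  ... | ≡b , ≡b+1 = mod-trans (mod-sym ≡b) ≡₀ , mod-trans (mod-sym ≡b+1) ≡₁

  period-* : ∀ {m a} q → Period m a → Period m (q *ℕ a)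
  period-* zero    pa = period-0
  period-* (suc q) pa = period-+ (period-* q pa) pa

  period-∣ : ∀ {d m k} → d ∣ℕ m → Period m k → Period d k
  period-∣ d∣m (≡₀ , ≡₁) = mod-∣ d∣m ≡₀ , mod-∣ d∣m ≡₁

  period-lcm : ∀ {a b k} → Period a k → Period b k → Period (lcm a b) k
  period-lcm (≡₀ , ≡₁) (≡₀′ , ≡₁′) = mod-lcm ≡₀ ≡₀′ , mod-lcm ≡₁ ≡₁′

  period-of-antiperiod : ∀ {m a} → F a ≡ 0ℤ mod m → F (suc a) ≡ - 1ℤ mod m → Period m (2 *ℕ a)
  period-of-antiperiod {m} {a} F[a]≡0 F[a+1]≡-1 with fib-shift (- 1ℤ) {a} {0} F[a]≡0 F[a+1]≡-1 a
  ... | F[2a]≡ , F[2a+1]≡ = subst (Period m) (cong (a +ℕ_) (sym (ℕₚ.+-identityʳ a)))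
    (mod-trans F[2a]≡ (negate {a} F[a]≡0) , mod-trans F[2a+1]≡ (negate {suc a} F[a+1]≡-1))
    where
    negate : ∀ {n c} → F n ≡ c mod m → - 1ℤ * F (n +ℕ 0) ≡ - 1ℤ * c mod m
    negate {n} F[n]≡c =
      *-cong-mod (≡⇒≡mod {y = - 1ℤ} refl) (mod-trans (≡⇒≡mod (cong F (ℕₚ.+-identityʳ n))) F[n]≡c)

-- The Pisano period
module _ where
  open Int using (_+_; _*_; _-_; -_)
  open Nat using () renaming (_+_ to _+ℕ_; _*_ to _*ℕ_; _∸_ to _∸ℕ_)
  open import Data.Integer.Tactic.RingSolver using (solve-∀)

  %≡⇒mod : ∀ {m x y} .{{_ : NonZero m}} → x Nat.% m ≡ y Nat.% m → + x ≡ + y mod m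
  %≡⇒mod {m} {x} {y} x%m≡y%m = mkMod (ℤ∣.divides (+ (x Nat./ m) - + (y Nat./ m)) (begin
    + x - + y
      ≡⟨ cong₂ _-_ (a≡a%ℕn+[a/ℕn]*n (+ x) m) (a≡a%ℕn+[a/ℕn]*n (+ y) m) ⟩
    (+ (x Nat.% m) + + (x Nat./ m) * + m) - (+ (y Nat.% m) + + (y Nat./ m) * + m)
      ≡⟨ cong (λ r → (+ (x Nat.% m) + + (x Nat./ m) * + m) - (+ r + + (y Nat./ m) * + m)) x%m≡y%m ⟨
    (+ (x Nat.% m) + + (x Nat./ m) * + m) - (+ (x Nat.% m) + + (y Nat./ m) * + m)
      ≡⟨ cancel (+ (x Nat.% m)) (+ (x Nat./ m)) (+ (y Nat./ m)) (+ m) ⟩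
    (+ (x Nat./ m) - + (y Nat./ m)) * + m ∎))
    where
    open ≡-Reasoning
    cancel : ∀ r a b k → (r + a * k) - (r + b * k) ≡ (a - b) * k
    cancel = solve-∀

  ∣∸-of-mod : ∀ {m x y} → y ≤ x → + x ≡ + y mod m → m ∣ℕ x ∸ℕ y
  ∣∸-of-mod {m} {x} {y} y≤x (mkMod m∣) =
    subst (m ∣ℕ_) (cong Int.∣_∣ (trans (ℤₚ.m-n≡m⊖n x y) (ℤₚ.⊖-≥ y≤x))) (ℤ∣.∣⇒∣ᵤ m∣)

  mod⇒%≡ : ∀ {m x y} .{{_ : NonZero m}} → + x ≡ + y mod m → x Nat.% m ≡ y Nat.% m
  mod⇒%≡ {m} {x} {y} x≡y with ℕₚ.≤-total y x
  ... | inj₁ y≤x = %-of-+∸ y≤x (∣∸-of-mod y≤x x≡y)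
    where
    %-of-+∸ : ∀ {a b} → a ≤ b → m ∣ℕ b ∸ℕ a → b Nat.% m ≡ a Nat.% m
    %-of-+∸ {a} a≤b m∣ = trans (cong (Nat._% m) (sym (ℕₚ.m+[n∸m]≡n a≤b))) (%-remove-+ʳ a m∣)
  ... | inj₂ x≤y = sym (trans (cong (Nat._% m) (sym (ℕₚ.m+[n∸m]≡n x≤y)))
                              (%-remove-+ʳ x (∣∸-of-mod x≤y (mod-sym x≡y))))

  isPeriod⇒Period : ∀ n k → T (isPeriod (suc n) k) → Period (suc n) k
  isPeriod⇒Period n k holds with Equivalence.to T-∧ holds
  ... | F≡0ᵇ , F≡1ᵇ = %≡⇒mod (ℕₚ.≡ᵇ⇒≡ _ _ F≡0ᵇ) , %≡⇒mod (ℕₚ.≡ᵇ⇒≡ _ _ F≡1ᵇ)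

  Period⇒isPeriod : ∀ n k → Period (suc n) k → T (isPeriod (suc n) k)
  Period⇒isPeriod n k (F≡0 , F≡1) =
    Equivalence.from T-∧ (ℕₚ.≡⇒≡ᵇ _ _ (mod⇒%≡ F≡0) , ℕₚ.≡⇒≡ᵇ _ _ (mod⇒%≡ F≡1))

  first-spec : ∀ (P : ℕ → Bool) s f {k} → s ≤ k → k < s +ℕ f → T (P k) →
               T (P (first P s f)) × s ≤ first P s f × (∀ i → s ≤ i → i < first P s f → ¬ T (P i))
  first-spec P s zero s≤k k<s+0 _ =
    ⊥-elim (ℕₚ.<-irrefl refl (ℕₚ.<-≤-trans k<s+0 (subst (_≤ _) (sym (ℕₚ.+-identityʳ s)) s≤k)))
  first-spec P s (suc f) {k} s≤k k<s+f Pk with P s in Ps≡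
  ... | true  = subst T (sym Ps≡) _ , ℕₚ.≤-refl , λ i s≤i i<s → ⊥-elim (ℕₚ.<⇒≱ i<s s≤i)
  ... | false with ℕₚ.m≤n⇒m<n∨m≡n s≤k
  ...   | inj₂ refl = ⊥-elim (subst T Ps≡ Pk)
  ...   | inj₁ s<k with first-spec P (suc s) f s<k (subst (k <_) (ℕₚ.+-suc s f) k<s+f) Pk
  ...     | Pfirst , s<first , below = Pfirst , ℕₚ.<⇒≤ s<first , below′
    where
    below′ : ∀ i → s ≤ i → i < first P (suc s) f → ¬ T (P i)
    below′ i s≤i i<first with ℕₚ.m≤n⇒m<n∨m≡n s≤i
    ... | inj₁ s<i = below i s<i i<first
    ... | inj₂ refl = subst T Ps≡

  F-back : ∀ n → F n ≡ F (suc (suc n)) - F (suc n)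
  F-back n = trans (sym (x+y-x≡y (F (suc n)) (F n))) (cong (_- F (suc n)) (sym (F-rec n)))
    where
    x+y-x≡y : ∀ x y → (x + y) - x ≡ y
    x+y-x≡y = solve-∀

  period-of-repeat : ∀ {m} i d → F (d +ℕ i) ≡ F i mod m → F (suc (d +ℕ i)) ≡ F (suc i) mod m →
                     Period m d
  period-of-repeat zero d ≡₀ ≡₁ rewrite ℕₚ.+-identityʳ d = ≡₀ , ≡₁
  period-of-repeat {m} (suc i) d ≡₀ ≡₁ rewrite ℕₚ.+-suc d i = period-of-repeat i d ≡₋₁ ≡₀
    where
    open import Relation.Binary.Reasoning.Setoid (mod-setoid m)
    ≡₋₁ : F (d +ℕ i) ≡ F i mod m
    ≡₋₁ = begin
      F (d +ℕ i)                                ≡⟨ F-back (d +ℕ i) ⟩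
      F (suc (suc (d +ℕ i))) - F (suc (d +ℕ i)) ≈⟨ +-cong-mod ≡₁ (neg-cong-mod ≡₀) ⟩
      F (suc (suc i)) - F (suc i)               ≡⟨ F-back i ⟨
      F i                                       ∎

  -- Pigeonhole on pairs of consecutive residues, then run the recurrence backwards.
  period-exists : ∀ m .{{_ : NonZero m}} → ∃ λ k → 1 ≤ k × k ≤ m *ℕ m × Period m k
  period-exists m with Fin.pigeonhole (ℕₚ.n<1+n (m *ℕ m)) residues
    where
    residues : Fin (suc (m *ℕ m)) → Fin (m *ℕ m)
    residues i = Fin.combine (fib (Fin.toℕ i) DivMod.mod m) (fib (suc (Fin.toℕ i)) DivMod.mod m)
  ... | i , j , i<j , same with Fin.combine-injective _ _ _ _ same
  ...   | ≡₀ , ≡₁ = d , ℕₚ.m<n⇒0<n∸m i<j , d≤m*m ,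
                    period-of-repeat (Fin.toℕ i) d (at-d+i {fib} (agree ≡₀)) (at-d+i {fib ∘ suc} (agree ≡₁))
    where
    d = Fin.toℕ j ∸ℕ Fin.toℕ i
    d≤m*m : d ≤ m *ℕ m
    d≤m*m = ℕₚ.≤-trans (ℕₚ.m∸n≤m (Fin.toℕ j) (Fin.toℕ i)) (ℕₚ.≤-pred (Fin.toℕ<n j))
    j≡d+i : Fin.toℕ j ≡ d +ℕ Fin.toℕ i
    j≡d+i = sym (ℕₚ.m∸n+n≡m (ℕₚ.<⇒≤ i<j))
    agree : ∀ {a b} → a DivMod.mod m ≡ b DivMod.mod m → + b ≡ + a mod m
    agree eq = %≡⇒mod (sym (trans (sym (Fin.toℕ-fromℕ< _)) (trans (cong Fin.toℕ eq) (Fin.toℕ-fromℕ< _))))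
    at-d+i : ∀ {f : ℕ → ℕ} {x} → + f (Fin.toℕ j) ≡ x mod m → + f (d +ℕ Fin.toℕ i) ≡ x mod m
    at-d+i {f} {x} = subst (λ n → + f n ≡ x mod m) j≡d+i

  pisano-spec : ∀ n → Period (suc n) (pisano (suc n)) × 1 ≤ pisano (suc n) ×
                      (∀ i → 1 ≤ i → i < pisano (suc n) → ¬ Period (suc n) i)
  pisano-spec n = isPeriod⇒Period n _ holds , 1≤π ,
                  λ i 1≤i i<π period-i → below i 1≤i i<π (Period⇒isPeriod n i period-i)
    where
    witness = period-exists (suc n)
    k = proj₁ witness
    spec = first-spec (isPeriod (suc n)) 1 (suc n *ℕ suc n) (proj₁ (proj₂ witness))
                      (s≤s (proj₁ (proj₂ (proj₂ witness)))) (Period⇒isPeriod n k (proj₂ (proj₂ (proj₂ witness))))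
    holds = proj₁ spec
    1≤π = proj₁ (proj₂ spec)
    below = proj₂ (proj₂ spec)

  fib-suc-positive : ∀ n → 1 ≤ fib (suc n)
  fib-suc-positive zero          = ℕₚ.≤-refl
  fib-suc-positive (suc zero)    = ℕₚ.≤-refl
  fib-suc-positive (suc (suc n)) = ℕₚ.≤-trans (fib-suc-positive (suc n)) (ℕₚ.m≤m+n _ _)

  period-mod-0⇒≡0 : ∀ {k} → Period 0 k → k ≡ 0
  period-mod-0⇒≡0 {zero}  _                  = refl
  period-mod-0⇒≡0 {suc k} (mkMod 0∣F , _) =
    ⊥-elim (ℕₚ.n>0⇒n≢0 (fib-suc-positive k) (ℤₚ.+-injective (trans (sym (ℤₚ.+-identityʳ _)) (ℤ∣.0∣⇒≡0 0∣F))))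

  -- Modulo 0 only 0 is a period, matching pisano 0 = 0, so m may be 0 here and below.
  period⇒pisano∣ : ∀ {m k} → Period m k → pisano m ∣ℕ k
  period⇒pisano∣ {zero} period-k rewrite period-mod-0⇒≡0 period-k = ℕ∣.∣-refl
  period⇒pisano∣ {suc n} {k} period-k = ℕ∣.m%n≡0⇒n∣m k π (remainder≡0 (k Nat.% π) refl)
    where
    π = pisano (suc n)
    period-π = proj₁ (pisano-spec n)
    1≤π = proj₁ (proj₂ (pisano-spec n))
    below = proj₂ (proj₂ (pisano-spec n))
    instance
      π≢0 : NonZero π
      π≢0 = Nat.>-nonZero 1≤π
    period-rem : Period (suc n) (k Nat.% π)
    period-rem = period-∸ (period-* (k Nat./ π) period-π)
                          (subst (Period (suc n)) (m≡m%n+[m/n]*n k π) period-k)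
    remainder≡0 : ∀ r → k Nat.% π ≡ r → k Nat.% π ≡ 0
    remainder≡0 zero    eq = eq
    remainder≡0 (suc r) eq =
      ⊥-elim (below (suc r) (s≤s z≤n) (subst (_< π) eq (m%n<n k π)) (subst (Period (suc n)) eq period-rem))

  pisano∣⇒period : ∀ {m k} → pisano m ∣ℕ k → Period m k
  pisano∣⇒period {zero} π∣k rewrite ℕ∣.0∣⇒≡0 π∣k = period-0
  pisano∣⇒period {suc n} (divides q refl) = period-* q (proj₁ (pisano-spec n))

  pisano-period : ∀ m → Period m (pisano m)
  pisano-period m = pisano∣⇒period ℕ∣.∣-refl

  pisano-positive : ∀ {m} → 1 ≤ m → 1 ≤ pisano m
  pisano-positive {suc n} _ = proj₁ (proj₂ (pisano-spec n))

module _ where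
  open import Data.Nat.LCM using (m∣lcm[m,n]; n∣lcm[m,n])

  pisano-∣-mono : ∀ {d m} → d ∣ℕ m → pisano d ∣ℕ pisano m
  pisano-∣-mono d∣m = period⇒pisano∣ (period-∣ d∣m (pisano-period _))

  pisano-lcm : ∀ a b → pisano (lcm a b) ≡ lcm (pisano a) (pisano b)
  pisano-lcm a b = ℕ∣.∣-antisym
    (period⇒pisano∣ (period-lcm {a} {b} (pisano∣⇒period (m∣lcm[m,n] (pisano a) (pisano b)))
                                        (pisano∣⇒period (n∣lcm[m,n] (pisano a) (pisano b)))))
    (lcm-least (pisano-∣-mono (m∣lcm[m,n] a b)) (pisano-∣-mono (n∣lcm[m,n] a b)))

  pisano≡1⇒≡1 : ∀ {m} → pisano m ≡ 1 → m ≡ 1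
  pisano≡1⇒≡1 {m} π≡1 with subst (Period m) π≡1 (pisano-period m)
  ... | mkMod m∣1 , _ = ℕ∣.∣1⇒≡1 (ℤ∣.∣⇒∣ᵤ m∣1)

  pisano-≥2 : ∀ {m} → 2 ≤ m → 2 ≤ pisano m
  pisano-≥2 {m} 2≤m with pisano m in π≡ | pisano-positive {m} (ℕₚ.<⇒≤ 2≤m)
  ... | suc (suc _) | _ = s≤s (s≤s z≤n)
  ... | suc zero    | _ = ⊥-elim (ℕₚ.<-irrefl (sym (pisano≡1⇒≡1 π≡)) 2≤m)

-- Lifting periods to prime powers
module _ where
  open Int using (_+_; _*_; _-_; -_)
  open Nat using () renaming (_+_ to _+ℕ_; _*_ to _*ℕ_; _^_ to _^ℕ_)
  open import Data.Integer.Tactic.RingSolver using (solve-∀)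

  F-+ : ∀ a b → F (b +ℕ a) ≡ F a * F (suc b) + F (suc a) * F b - F a * F b ×
                F (suc (b +ℕ a)) ≡ F (suc a) * F (suc b) + F a * F b
  F-+ a zero = sym (id₀ (F a) (F (suc a))) , sym (id₁ (F (suc a)) (F a))
    where
    id₀ : ∀ x y → x * 1ℤ + y * 0ℤ - x * 0ℤ ≡ x
    id₀ = solve-∀
    id₁ : ∀ x y → x * 1ℤ + y * 0ℤ ≡ x
    id₁ = solve-∀
  F-+ a (suc b) with F-+ a b
  ... | F[b+a] , F[b+a+1] = F[b+a+1]′ , F[b+a+2]
    where
    A  = F a
    A′ = F (suc a)
    B  = F b
    B′ = F (suc b)
    F[b+a+1]′ : F (suc (b +ℕ a)) ≡ A * F (suc (suc b)) + A′ * B′ - A * B′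
    F[b+a+1]′ = trans F[b+a+1] (trans (regroup A A′ B B′) (cong (λ z → A * z + A′ * B′ - A * B′) (sym (F-rec b))))
      where
      regroup : ∀ A A′ B B′ → A′ * B′ + A * B ≡ A * (B′ + B) + A′ * B′ - A * B′
      regroup = solve-∀
    F[b+a+2] : F (suc (suc (b +ℕ a))) ≡ A′ * F (suc (suc b)) + A * B′
    F[b+a+2] = trans (F-rec (b +ℕ a)) (trans (cong₂ _+_ F[b+a+1] F[b+a])
                 (trans (regroup A A′ B B′) (cong (λ z → A′ * z + A * B′) (sym (F-rec b)))))
      where
      regroup : ∀ A A′ B B′ → (A′ * B′ + A * B) + (A * B′ + A′ * B - A * B) ≡ A′ * (B′ + B) + A * B′
      regroup = solve-∀

  ≡-by-multiple : ∀ {q a b} t → a - b ≡ t * + q → a ≡ b mod q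
  ≡-by-multiple t eq = mkMod (ℤ∣.divides t eq)

  ≡-by-multiple-* : ∀ {p q a b} t → a - b ≡ t * (+ p * + q) → a ≡ b mod (p *ℕ q)
  ≡-by-multiple-* {p} {q} t eq = ≡-by-multiple t (trans eq (cong (t *_) (sym (ℤₚ.pos-* p q))))

  F-multiples : ∀ {q k} x y → F k ≡ x * + q → F (suc k) ≡ 1ℤ + y * + q → ∀ j →
    F (j *ℕ k) ≡ + j * x * + q mod (q *ℕ q) × F (suc (j *ℕ k)) ≡ 1ℤ + + j * y * + q mod (q *ℕ q)
  F-multiples {q} x y F[k] F[k+1] zero = ≡⇒≡mod (sym (zero₀ x (+ q))) , ≡⇒≡mod (sym (zero₁ y (+ q)))
    where
    zero₀ : ∀ x q → 0ℤ * x * q ≡ 0ℤ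
    zero₀ = solve-∀
    zero₁ : ∀ y q → 1ℤ + 0ℤ * y * q ≡ 1ℤ
    zero₁ = solve-∀
  F-multiples {q} {k} x y F[k] F[k+1] (suc j) with F-multiples x y F[k] F[k+1] j | F-+ (j *ℕ k) k
  ... | ≡jk , ≡jk+1 | F[k+jk] , F[k+jk+1] = ≡[j+1]k , ≡[j+1]k+1
    where
    open import Relation.Binary.Reasoning.Setoid (mod-setoid (q *ℕ q))
    J = + j
    Q = + q
    ≡[j+1]k : F (k +ℕ j *ℕ k) ≡ + suc j * x * Q mod (q *ℕ q)
    ≡[j+1]k = begin
      F (k +ℕ j *ℕ k)
        ≡⟨ F[k+jk] ⟩
      F (j *ℕ k) * F (suc k) + F (suc (j *ℕ k)) * F k - F (j *ℕ k) * F k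
        ≈⟨ +-cong-mod (+-cong-mod (*-cong-mod ≡jk (≡⇒≡mod F[k+1])) (*-cong-mod ≡jk+1 (≡⇒≡mod F[k])))
                      (neg-cong-mod (*-cong-mod ≡jk (≡⇒≡mod F[k]))) ⟩
      (J * x * Q) * (1ℤ + y * Q) + (1ℤ + J * y * Q) * (x * Q) - (J * x * Q) * (x * Q)
        ≈⟨ ≡-by-multiple-* {q} {q} (J * x * y + J * y * x - J * x * x) (expand J x y Q) ⟩
      (1ℤ + J) * x * Q ∎
      where
      expand : ∀ J x y Q →
        ((J * x * Q) * (1ℤ + y * Q) + (1ℤ + J * y * Q) * (x * Q) - (J * x * Q) * (x * Q)) - (1ℤ + J) * x * Q
        ≡ (J * x * y + J * y * x - J * x * x) * (Q * Q)
      expand = solve-∀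
    ≡[j+1]k+1 : F (suc (k +ℕ j *ℕ k)) ≡ 1ℤ + + suc j * y * Q mod (q *ℕ q)
    ≡[j+1]k+1 = begin
      F (suc (k +ℕ j *ℕ k))
        ≡⟨ F[k+jk+1] ⟩
      F (suc (j *ℕ k)) * F (suc k) + F (j *ℕ k) * F k
        ≈⟨ +-cong-mod (*-cong-mod ≡jk+1 (≡⇒≡mod F[k+1])) (*-cong-mod ≡jk (≡⇒≡mod F[k])) ⟩
      (1ℤ + J * y * Q) * (1ℤ + y * Q) + (J * x * Q) * (x * Q)
        ≈⟨ ≡-by-multiple-* {q} {q} (J * y * y + J * x * x) (expand J x y Q) ⟩
      1ℤ + (1ℤ + J) * y * Q ∎
      where
      expand : ∀ J x y Q →
        ((1ℤ + J * y * Q) * (1ℤ + y * Q) + (J * x * Q) * (x * Q)) - (1ℤ + (1ℤ + J) * y * Q)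
        ≡ (J * y * y + J * x * x) * (Q * Q)
      expand = solve-∀

  period-lift : ∀ {p q k} → p ∣ℕ q → Period q k → Period (p *ℕ q) (p *ℕ k)
  period-lift {p} {q} {k} p∣q (mkMod (ℤ∣.divides x F[k]-0≡xq) , mkMod (ℤ∣.divides y F[k+1]-1≡yq))
    with F-multiples x y (trans (sym (ℤₚ.+-identityʳ _)) F[k]-0≡xq) (trans (sym (a≡1+[a-1] _)) (cong (_+_ 1ℤ) F[k+1]-1≡yq)) p
    where
    a≡1+[a-1] : ∀ a → 1ℤ + (a - 1ℤ) ≡ a
    a≡1+[a-1] = solve-∀
  ... | ≡pk , ≡pk+1 = mod-trans (mod-∣ pq∣qq ≡pk) (≡-by-multiple-* {p} {q} x (regroup₀ (+ p) x (+ q))) ,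
                      mod-trans (mod-∣ pq∣qq ≡pk+1) (≡-by-multiple-* {p} {q} y (regroup₁ (+ p) y (+ q)))
    where
    pq∣qq : p *ℕ q ∣ℕ q *ℕ q
    pq∣qq = ℕ∣.*-monoˡ-∣ q p∣q
    regroup₀ : ∀ p x q → p * x * q - 0ℤ ≡ x * (p * q)
    regroup₀ = solve-∀
    regroup₁ : ∀ p y q → (1ℤ + p * y * q) - 1ℤ ≡ y * (p * q)
    regroup₁ = solve-∀

  period-pow : ∀ {p k} → Period p k → ∀ e → Period (p ^ℕ suc e) (p ^ℕ e *ℕ k)
  period-pow {p} {k} period-k zero = subst₂ Period (sym (ℕₚ.*-identityʳ p)) (sym (ℕₚ.*-identityˡ k)) period-k
  period-pow {p} {k} period-k (suc e) =
    subst (Period (p ^ℕ suc (suc e))) (sym (ℕₚ.*-assoc p (p ^ℕ e) k))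
          (period-lift {p} (ℕ∣.m∣m*n (p ^ℕ e)) (period-pow period-k e))

-- The Pisano period of a prime p ∉ {2, 5}
module _ where
  open Nat using (_+_; _*_)
  open import Data.Nat.Combinatorics using (_C_; nC1≡n; nCk+nC[k+1]≡[n+1]C[k+1])
  open import Data.Nat.Combinatorics.Specification using (k>n⇒nCk≡0)
  open import Data.Nat.Tactic.RingSolver using (solve-∀)

  [k+1]*[n+1]C[k+1]≡[n+1]*nCk : ∀ n k → suc k * (suc n C suc k) ≡ suc n * (n C k)
  [k+1]*[n+1]C[k+1]≡[n+1]*nCk zero zero = refl
  [k+1]*[n+1]C[k+1]≡[n+1]*nCk zero (suc k)
    rewrite k>n⇒nCk≡0 {1} {suc (suc k)} (s≤s (s≤s z≤n)) | k>n⇒nCk≡0 {0} {suc k} (s≤s z≤n)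
    = ℕₚ.*-zeroʳ (suc (suc k))
  [k+1]*[n+1]C[k+1]≡[n+1]*nCk (suc n) zero =
    trans (ℕₚ.*-identityˡ _) (trans (nC1≡n (suc (suc n))) (sym (ℕₚ.*-identityʳ (suc (suc n)))))
  [k+1]*[n+1]C[k+1]≡[n+1]*nCk (suc n) (suc k) = begin
    suc (suc k) * (suc (suc n) C suc (suc k))
      ≡⟨ cong (suc (suc k) *_) (nCk+nC[k+1]≡[n+1]C[k+1] (suc n) (suc k)) ⟨
    suc (suc k) * (suc n C suc k + suc n C suc (suc k))
      ≡⟨ split k (suc n C suc k) (suc n C suc (suc k)) ⟩
    suc n C suc k + suc k * (suc n C suc k) + suc (suc k) * (suc n C suc (suc k))
      ≡⟨ cong₂ (λ a b → suc n C suc k + a + b) ([k+1]*[n+1]C[k+1]≡[n+1]*nCk n k) ([k+1]*[n+1]C[k+1]≡[n+1]*nCk n (suc k)) ⟩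
    suc n C suc k + suc n * (n C k) + suc n * (n C suc k)
      ≡⟨ merge n (suc n C suc k) (n C k) (n C suc k) ⟩
    suc n C suc k + suc n * (n C k + n C suc k)
      ≡⟨ cong (λ c → suc n C suc k + suc n * c) (nCk+nC[k+1]≡[n+1]C[k+1] n k) ⟩
    suc (suc n) * (suc n C suc k) ∎
    where
    open ≡-Reasoning
    split : ∀ k a b → suc (suc k) * (a + b) ≡ a + suc k * a + suc (suc k) * b
    split = solve-∀
    merge : ∀ n c a b → c + suc n * a + suc n * b ≡ c + suc n * (a + b)
    merge = solve-∀

  prime∣pCk : ∀ {p k} → Prime p → 0 < k → k < p → p ∣ℕ p C k
  prime∣pCk {suc n} {suc k} p-prime _ k<p
    with euclidsLemma (suc k) (suc n C suc k) p-prime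
           (divides (n C k) (trans ([k+1]*[n+1]C[k+1]≡[n+1]*nCk n k) (ℕₚ.*-comm (suc n) (n C k))))
  ... | inj₂ p∣C = p∣C
  ... | inj₁ p∣k+1 = ⊥-elim (ℕₚ.<-irrefl refl (ℕₚ.<-≤-trans k<p (ℕ∣.∣⇒≤ p∣k+1)))

module _ {c ℓ} (R : CommutativeSemiring c ℓ) where
  open CommutativeSemiring R hiding (refl; sym) renaming (trans to ≈-trans)
  open import Algebra.Properties.Semiring.Exp semiring using (_^_)
  open import Algebra.Properties.Semiring.Mult semiring using (×-assocˡ; ×-congʳ; ×-cong; ×-homo-1) renaming (_×_ to _·_)
  open import Algebra.Properties.Semiring.Sum semiring using (sum; sum-cong-≋; sum-replicate; sum-replicate-zero; sum-init-last)
  open import Algebra.Properties.CommutativeSemiring.Binomial R using (theorem; binomialTerm)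
  open import Data.Nat.Combinatorics using (_C_; nCn≡1)
  open import Relation.Binary.Reasoning.Setoid setoid

  frobenius : ∀ {p} → Prime p → (∀ x → p · x ≈ 0#) → ∀ x y → (x + y) ^ p ≈ x ^ p + y ^ p
  frobenius {suc q} p-prime char-p x y = begin
    (x + y) ^ suc q
      ≈⟨ theorem (suc q) x y ⟩
    binomialTerm x y (suc q) Fin.zero + sum (λ i → binomialTerm x y (suc q) (Fin.suc i))
      ≈⟨ +-congˡ (sum-init-last (λ i → binomialTerm x y (suc q) (Fin.suc i))) ⟩
    binomialTerm x y (suc q) Fin.zero
      + (sum (λ i → binomialTerm x y (suc q) (Fin.suc (Fin.inject₁ i))) + binomialTerm x y (suc q) (Fin.fromℕ (suc q)))
      ≈⟨ +-cong first-term (+-cong middle-terms last-term) ⟩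
    y ^ suc q + (0# + x ^ suc q)
      ≈⟨ +-congˡ (+-identityˡ _) ⟩
    y ^ suc q + x ^ suc q
      ≈⟨ +-comm _ _ ⟩
    x ^ suc q + y ^ suc q ∎
    where
    multiple·≈0 : ∀ n z → suc q ∣ℕ n → n · z ≈ 0#
    multiple·≈0 _ z (divides c refl) = begin
      (c Nat.* suc q) · z ≈⟨ ×-assocˡ z c (suc q) ⟨
      c · (suc q · z)     ≈⟨ ×-congʳ c (char-p z) ⟩
      c · 0#              ≈⟨ sum-replicate c ⟨
      sum {c} (λ _ → 0#)  ≈⟨ sum-replicate-zero c ⟩
      0# ∎
    first-term : binomialTerm x y (suc q) Fin.zero ≈ y ^ suc q
    first-term = ≈-trans (×-homo-1 _) (*-identityˡ _)
    middle-terms : sum (λ i → binomialTerm x y (suc q) (Fin.suc (Fin.inject₁ i))) ≈ 0#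
    middle-terms = ≈-trans (sum-cong-≋ {q} λ i → multiple·≈0 _ _ (prime∣pCk p-prime (s≤s z≤n)
                           (s≤s (subst (_< q) (sym (Fin.toℕ-inject₁ i)) (Fin.toℕ<n i)))))
                         (sum-replicate-zero q)
    last-term : binomialTerm x y (suc q) (Fin.fromℕ (suc q)) ≈ x ^ suc q
    last-term = top-term (Fin.toℕ-fromℕ (suc q))
      where
      top-term : ∀ {k} → k ≡ suc q → (suc q C k) · (x ^ k * y ^ (suc q Nat.∸ k)) ≈ x ^ suc q
      top-term refl = begin
        (suc q C suc q) · (x ^ suc q * y ^ (q Nat.∸ q))
          ≈⟨ ×-cong (nCn≡1 (suc q)) (*-congˡ (reflexive (cong (y ^_) (ℕₚ.n∸n≡0 q)))) ⟩
        1 · (x ^ suc q * 1#) ≈⟨ ×-homo-1 _ ⟩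
        x ^ suc q * 1#       ≈⟨ *-identityʳ _ ⟩
        x ^ suc q            ∎

-- ℤ[√d] modulo p, where the pair (a , b) stands for a + b √d.
module QuadraticMod (d : ℤ) (p : ℕ) where
  open Int using (_+_; _*_)
  open import Data.Integer.Tactic.RingSolver using (solve-∀)
  open import Algebra.Structures.Biased using (isCommutativeMonoidˡ; isCommutativeSemiringˡ)

  infixl 6 _⊕_
  infixl 7 _⊗_
  infix  4 _≈_

  _≈_ : ℤ × ℤ → ℤ × ℤ → Set
  (a , b) ≈ (a′ , b′) = a ≡ a′ mod p × b ≡ b′ mod p

  _⊕_ : ℤ × ℤ → ℤ × ℤ → ℤ × ℤ
  (a , b) ⊕ (a′ , b′) = a + a′ , b + b′

  _⊗_ : ℤ × ℤ → ℤ × ℤ → ℤ × ℤ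
  (a , b) ⊗ (a′ , b′) = a * a′ + d * (b * b′) , a * b′ + b * a′

  ≈-reflexive : ∀ {x y} → x ≡ y → x ≈ y
  ≈-reflexive refl = ≡⇒≡mod refl , ≡⇒≡mod refl

  ⊕-assoc : ∀ x y z → (x ⊕ y) ⊕ z ≡ x ⊕ (y ⊕ z)
  ⊕-assoc (a , b) (a′ , b′) (a″ , b″) = cong₂ _,_ (ℤₚ.+-assoc a a′ a″) (ℤₚ.+-assoc b b′ b″)

  ⊕-comm : ∀ x y → x ⊕ y ≡ y ⊕ x
  ⊕-comm (a , b) (a′ , b′) = cong₂ _,_ (ℤₚ.+-comm a a′) (ℤₚ.+-comm b b′)

  ⊕-identityˡ : ∀ x → (0ℤ , 0ℤ) ⊕ x ≡ x
  ⊕-identityˡ (a , b) = cong₂ _,_ (ℤₚ.+-identityˡ a) (ℤₚ.+-identityˡ b)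

  ⊗-assoc : ∀ x y z → (x ⊗ y) ⊗ z ≡ x ⊗ (y ⊗ z)
  ⊗-assoc (a , b) (a′ , b′) (a″ , b″) =
    cong₂ _,_ (rational d a b a′ b′ a″ b″) (irrational d a b a′ b′ a″ b″)
    where
    rational : ∀ d a b a′ b′ a″ b″ →
      (a * a′ + d * (b * b′)) * a″ + d * ((a * b′ + b * a′) * b″)
      ≡ a * (a′ * a″ + d * (b′ * b″)) + d * (b * (a′ * b″ + b′ * a″))
    rational = solve-∀
    irrational : ∀ d a b a′ b′ a″ b″ →
      (a * a′ + d * (b * b′)) * b″ + (a * b′ + b * a′) * a″
      ≡ a * (a′ * b″ + b′ * a″) + b * (a′ * a″ + d * (b′ * b″))
    irrational = solve-∀

  ⊗-comm : ∀ x y → x ⊗ y ≡ y ⊗ x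
  ⊗-comm (a , b) (a′ , b′) = cong₂ _,_ (rational d a b a′ b′) (irrational a b a′ b′)
    where
    rational : ∀ d a b a′ b′ → a * a′ + d * (b * b′) ≡ a′ * a + d * (b′ * b)
    rational = solve-∀
    irrational : ∀ a b a′ b′ → a * b′ + b * a′ ≡ a′ * b + b′ * a
    irrational = solve-∀

  ⊗-identityˡ : ∀ x → (1ℤ , 0ℤ) ⊗ x ≡ x
  ⊗-identityˡ (a , b) = cong₂ _,_ (rational d a b) (irrational a b)
    where
    rational : ∀ d a b → 1ℤ * a + d * (0ℤ * b) ≡ a
    rational = solve-∀
    irrational : ∀ a b → 1ℤ * b + 0ℤ * a ≡ b
    irrational = solve-∀

  ⊗-distribʳ : ∀ x y z → (y ⊕ z) ⊗ x ≡ y ⊗ x ⊕ z ⊗ x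
  ⊗-distribʳ (a , b) (a′ , b′) (a″ , b″) =
    cong₂ _,_ (rational d a b a′ b′ a″ b″) (irrational a b a′ b′ a″ b″)
    where
    rational : ∀ d a b a′ b′ a″ b″ →
      (a′ + a″) * a + d * ((b′ + b″) * b) ≡ (a′ * a + d * (b′ * b)) + (a″ * a + d * (b″ * b))
    rational = solve-∀
    irrational : ∀ a b a′ b′ a″ b″ → (a′ + a″) * b + (b′ + b″) * a ≡ (a′ * b + b′ * a) + (a″ * b + b″ * a)
    irrational = solve-∀

  ⊗-zeroˡ : ∀ x → (0ℤ , 0ℤ) ⊗ x ≡ (0ℤ , 0ℤ)
  ⊗-zeroˡ (a , b) = cong₂ _,_ (rational d a b) (irrational a b)
    where
    rational : ∀ d a b → 0ℤ * a + d * (0ℤ * b) ≡ 0ℤ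
    rational = solve-∀
    irrational : ∀ a b → 0ℤ * b + 0ℤ * a ≡ 0ℤ
    irrational = solve-∀

  ≈-isEquivalence : IsEquivalence _≈_
  ≈-isEquivalence = record
    { refl  = ≈-reflexive refl
    ; sym   = λ (≈₁ , ≈₂) → mod-sym ≈₁ , mod-sym ≈₂
    ; trans = λ (≈₁ , ≈₂) (≈₁′ , ≈₂′) → mod-trans ≈₁ ≈₁′ , mod-trans ≈₂ ≈₂′
    }

  ⊕-cong : ∀ {x y u v} → x ≈ y → u ≈ v → x ⊕ u ≈ y ⊕ v
  ⊕-cong {_ , _} {_ , _} {_ , _} {_ , _} (≈₁ , ≈₂) (≈₁′ , ≈₂′) = +-cong-mod ≈₁ ≈₁′ , +-cong-mod ≈₂ ≈₂′

  ⊗-cong : ∀ {x y u v} → x ≈ y → u ≈ v → x ⊗ u ≈ y ⊗ v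
  ⊗-cong {_ , _} {_ , _} {_ , _} {_ , _} (≈₁ , ≈₂) (≈₁′ , ≈₂′) =
    +-cong-mod (*-cong-mod ≈₁ ≈₁′) (*-cong-mod (≡⇒≡mod {y = d} refl) (*-cong-mod ≈₂ ≈₂′)) ,
    +-cong-mod (*-cong-mod ≈₁ ≈₂′) (*-cong-mod ≈₂ ≈₁′)

  commutativeSemiring : CommutativeSemiring _ _
  commutativeSemiring = record
    { isCommutativeSemiring = isCommutativeSemiringˡ record
      { +-isCommutativeMonoid = commutativeMonoid _⊕_ (0ℤ , 0ℤ) ⊕-cong ⊕-assoc ⊕-identityˡ ⊕-comm
      ; *-isCommutativeMonoid = commutativeMonoid _⊗_ (1ℤ , 0ℤ) ⊗-cong ⊗-assoc ⊗-identityˡ ⊗-comm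
      ; distribʳ              = λ x y z → ≈-reflexive (⊗-distribʳ x y z)
      ; zeroˡ                 = λ x → ≈-reflexive (⊗-zeroˡ x)
      }
    }
    where
    commutativeMonoid : ∀ _∙_ e → (∀ {x y u v} → x ≈ y → u ≈ v → (x ∙ u) ≈ (y ∙ v)) →
      (∀ x y z → (x ∙ y) ∙ z ≡ x ∙ (y ∙ z)) → (∀ x → e ∙ x ≡ x) → (∀ x y → x ∙ y ≡ y ∙ x) →
      IsCommutativeMonoid _≈_ _∙_ e
    commutativeMonoid _∙_ e cong assoc identityˡ comm = isCommutativeMonoidˡ record
      { isSemigroup = record
        { isMagma = record { isEquivalence = ≈-isEquivalence ; ∙-cong = cong }
        ; assoc   = λ x y z → ≈-reflexive (assoc x y z)
        }
      ; identityˡ = λ x → ≈-reflexive (identityˡ x)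
      ; comm      = λ x y → ≈-reflexive (comm x y)
      }

module _ {p : ℕ} (p-prime : Prime p) where
  open Int using (_+_; _*_; _-_; -_; _^_)
  open ℤ∣ using (_∣_)
  open import Data.Integer.Tactic.RingSolver using (solve-∀)
  open QuadraticMod (+ 5) p
  open import Algebra.Properties.Semiring.Exp (CommutativeSemiring.semiring commutativeSemiring) using () renaming (_^_ to _^ᵣ_)
  open import Algebra.Properties.Semiring.Mult (CommutativeSemiring.semiring commutativeSemiring) using () renaming (_×_ to _·_)

  prime-∣* : ∀ a b → + p ∣ a * b → + p ∣ a ⊎ + p ∣ b
  prime-∣* a b p∣ab
    with euclidsLemma Int.∣ a ∣ Int.∣ b ∣ p-prime (subst (p ∣ℕ_) (ℤₚ.abs-* a b) (ℤ∣.∣⇒∣ᵤ p∣ab))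
  ... | inj₁ p∣a = inj₁ (ℤ∣.∣ᵤ⇒∣ p∣a)
  ... | inj₂ p∣b = inj₂ (ℤ∣.∣ᵤ⇒∣ p∣b)

  mod-cancel : ∀ {c x y} → ¬ p ∣ℕ c → + c * x ≡ + c * y mod p → x ≡ y mod p
  mod-cancel {c} {x} {y} p∤c (mkMod p∣) with prime-∣* (+ c) (x - y) (subst (+ p ∣_) (factor (+ c) x y) p∣)
    where
    factor : ∀ c x y → c * x - c * y ≡ c * (x - y)
    factor = solve-∀
  ... | inj₁ p∣c   = ⊥-elim (p∤c (ℤ∣.∣⇒∣ᵤ p∣c))
  ... | inj₂ p∣x-y = mkMod p∣x-y

  mod-square≡1 : ∀ {e} → e * e ≡ 1ℤ mod p → e ≡ 1ℤ mod p ⊎ e ≡ - 1ℤ mod p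
  mod-square≡1 {e} (mkMod p∣) with prime-∣* (e - 1ℤ) (e - - 1ℤ) (subst (+ p ∣_) (factor e) p∣)
    where
    factor : ∀ e → e * e - 1ℤ ≡ (e - 1ℤ) * (e - - 1ℤ)
    factor = solve-∀
  ... | inj₁ p∣e-1 = inj₁ (mkMod p∣e-1)
  ... | inj₂ p∣e+1 = inj₂ (mkMod p∣e+1)

  ·-pair : ∀ n a b → n · (a , b) ≡ (+ n * a , + n * b)
  ·-pair zero    a b = refl
  ·-pair (suc n) a b = trans (cong ((a , b) ⊕_) (·-pair n a b)) (cong₂ _,_ (step (+ n) a) (step (+ n) b))
    where
    step : ∀ n a → a + n * a ≡ (1ℤ + n) * a
    step = solve-∀

  characteristic : ∀ x → p · x ≈ (0ℤ , 0ℤ)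
  characteristic (a , b) = subst (_≈ (0ℤ , 0ℤ)) (sym (·-pair p a b)) (multiple a , multiple b)
    where
    multiple : ∀ a → + p * a ≡ 0ℤ mod p
    multiple a = ≡-by-multiple a (trans (ℤₚ.+-identityʳ _) (ℤₚ.*-comm (+ p) a))

  integer-^ : ∀ a n → (a , 0ℤ) ^ᵣ n ≡ (a ^ n , 0ℤ)
  integer-^ a zero    = refl
  integer-^ a (suc n) = trans (cong ((a , 0ℤ) ⊗_) (integer-^ a n)) (cong₂ _,_ (rational (+ 5) a (a ^ n)) (irrational a (a ^ n)))
    where
    rational : ∀ d a b → a * b + d * (0ℤ * 0ℤ) ≡ a * b
    rational = solve-∀
    irrational : ∀ a b → a * 0ℤ + 0ℤ * b ≡ 0ℤ
    irrational = solve-∀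

  fermat : ∀ a → (+ a) ^ p ≡ + a mod p
  fermat zero    = ≡⇒≡mod (subst (λ n → 0ℤ ^ n ≡ 0ℤ) (ℕₚ.suc-pred p {{prime⇒nonZero p-prime}}) refl)
  fermat (suc a) = begin
    (+ suc a) ^ p
      ≡⟨ cong proj₁ (integer-^ (+ suc a) p) ⟨
    proj₁ (((1ℤ , 0ℤ) ⊕ (+ a , 0ℤ)) ^ᵣ p)
      ≈⟨ proj₁ (frobenius commutativeSemiring p-prime characteristic (1ℤ , 0ℤ) (+ a , 0ℤ)) ⟩
    proj₁ ((1ℤ , 0ℤ) ^ᵣ p ⊕ (+ a , 0ℤ) ^ᵣ p)
      ≡⟨ cong₂ (λ u v → proj₁ (u ⊕ v)) (integer-^ 1ℤ p) (integer-^ (+ a) p) ⟩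
    1ℤ ^ p + (+ a) ^ p
      ≈⟨ +-cong-mod (≡⇒≡mod (ℤₚ.^-zeroˡ p)) (fermat a) ⟩
    1ℤ + + a ∎
    where open import Relation.Binary.Reasoning.Setoid (mod-setoid p)

  fermat-∸1 : ∀ {a} → ¬ p ∣ℕ a → (+ a) ^ (p Nat.∸ 1) ≡ 1ℤ mod p
  fermat-∸1 {a} p∤a = mod-cancel p∤a (begin
    + a * (+ a) ^ (p Nat.∸ 1) ≡⟨ cong (_^_ (+ a)) (ℕₚ.suc-pred p {{prime⇒nonZero p-prime}}) ⟩
    (+ a) ^ p                 ≈⟨ fermat a ⟩
    + a                       ≡⟨ ℤₚ.*-identityʳ (+ a) ⟨
    + a * 1ℤ                  ∎)
    where open import Relation.Binary.Reasoning.Setoid (mod-setoid p)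

  1+√5-^ : ∀ n → (1ℤ , 1ℤ) ^ᵣ suc n ≡ ((+ 2) ^ n * (F n + F (suc (suc n))) , (+ 2) ^ n * F (suc n))
  1+√5-^ zero    = refl
  1+√5-^ (suc n) = trans (cong ((1ℤ , 1ℤ) ⊗_) (1+√5-^ n)) (cong₂ _,_ rational irrational)
    where
    t = (+ 2) ^ n
    a = F n
    b = F (suc n)
    F[n+3] : F (suc (suc (suc n))) ≡ (b + a) + b
    F[n+3] = trans (F-rec (suc n)) (cong (_+ b) (F-rec n))
    rational : 1ℤ * (t * (a + F (suc (suc n)))) + + 5 * (1ℤ * (t * b)) ≡ (+ 2 * t) * (b + F (suc (suc (suc n))))
    rational = begin
      1ℤ * (t * (a + F (suc (suc n)))) + + 5 * (1ℤ * (t * b)) ≡⟨ cong (λ c → 1ℤ * (t * (a + c)) + + 5 * (1ℤ * (t * b))) (F-rec n) ⟩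
      1ℤ * (t * (a + (b + a))) + + 5 * (1ℤ * (t * b))         ≡⟨ expand t a b ⟩
      (+ 2 * t) * (b + ((b + a) + b))                         ≡⟨ cong (λ c → (+ 2 * t) * (b + c)) F[n+3] ⟨
      (+ 2 * t) * (b + F (suc (suc (suc n))))                 ∎
      where
      open ≡-Reasoning
      expand : ∀ t a b → 1ℤ * (t * (a + (b + a))) + + 5 * (1ℤ * (t * b)) ≡ (+ 2 * t) * (b + ((b + a) + b))
      expand = solve-∀
    irrational : 1ℤ * (t * b) + 1ℤ * (t * (a + F (suc (suc n)))) ≡ (+ 2 * t) * F (suc (suc n))
    irrational = begin
      1ℤ * (t * b) + 1ℤ * (t * (a + F (suc (suc n)))) ≡⟨ cong (λ c → 1ℤ * (t * b) + 1ℤ * (t * (a + c))) (F-rec n) ⟩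
      1ℤ * (t * b) + 1ℤ * (t * (a + (b + a)))         ≡⟨ expand t a b ⟩
      (+ 2 * t) * (b + a)                             ≡⟨ cong (+ 2 * t *_) (F-rec n) ⟨
      (+ 2 * t) * F (suc (suc n))                     ∎
      where
      open ≡-Reasoning
      expand : ∀ t a b → 1ℤ * (t * b) + 1ℤ * (t * (a + (b + a))) ≡ (+ 2 * t) * (b + a)
      expand = solve-∀

  √5-^-odd : ∀ k → (0ℤ , 1ℤ) ^ᵣ suc (k Nat.+ k) ≡ (0ℤ , (+ 5) ^ k)
  √5-^-odd zero    = refl
  √5-^-odd (suc k) =
    trans (cong (λ n → (0ℤ , 1ℤ) ^ᵣ suc (suc n)) (ℕₚ.+-suc k k))
          (trans (cong (λ z → (0ℤ , 1ℤ) ⊗ ((0ℤ , 1ℤ) ⊗ z)) (√5-^-odd k)) (cong₂ _,_ (rational ((+ 5) ^ k)) (irrational ((+ 5) ^ k))))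
    where
    rational : ∀ c → 0ℤ * (0ℤ * 0ℤ + + 5 * (1ℤ * c)) + + 5 * (1ℤ * (0ℤ * c + 1ℤ * 0ℤ)) ≡ 0ℤ
    rational = solve-∀
    irrational : ∀ c → 0ℤ * (0ℤ * c + 1ℤ * 0ℤ) + 1ℤ * (0ℤ * 0ℤ + + 5 * (1ℤ * c)) ≡ + 5 * c
    irrational = solve-∀

  prime∤prime : ∀ {q} → Prime q → p ≢ q → ¬ p ∣ℕ q
  prime∤prime q-prime p≢q p∣q with prime⇒irreducible q-prime p∣q
  ... | inj₁ refl = ¬prime[1] p-prime
  ... | inj₂ p≡q  = p≢q p≡q

  odd-prime : p ≢ 2 → ∃ λ k → p ≡ suc (k Nat.+ k)
  odd-prime p≢2 with even-or-odd p
  ... | k , inj₂ p≡1+k+k = k , p≡1+k+k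
  ... | k , inj₁ p≡k+k with prime⇒irreducible p-prime (divides k (trans p≡k+k k+k≡k*2))
    where
    k+k≡k*2 : k Nat.+ k ≡ k Nat.* 2
    k+k≡k*2 = trans (cong (k Nat.+_) (sym (ℕₚ.+-identityʳ k))) (ℕₚ.*-comm 2 k)
  ...   | inj₂ 2≡p = ⊥-elim (p≢2 (sym 2≡p))

  -- (1 + √5) ^ p = 1 + √5 ^ p in ℤ[√5]/p, where (1 + √5) ^ (n + 1) = 2 ^ n (Lₙ₊₁ + Fₙ₊₁ √5)
  -- with Lucas number Lₙ₊₁ = Fₙ + Fₙ₊₂.
  frobenius-1+√5 : ∀ k → p ≡ suc (k Nat.+ k) → p ≢ 2 →
                   F (k Nat.+ k) + F (suc p) ≡ 1ℤ mod p × F p ≡ (+ 5) ^ k mod p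
  frobenius-1+√5 k refl p≢2 =
    mod-trans (without-2^m (proj₁ coordinates)) (≡⇒≡mod (trans (ℤₚ.+-identityʳ _) (ℤₚ.^-zeroˡ p))) ,
    mod-trans (without-2^m (proj₂ coordinates)) (≡⇒≡mod (ℤₚ.+-identityˡ _))
    where
    open import Relation.Binary.Reasoning.Setoid (mod-setoid p)
    m = k Nat.+ k
    coordinates : (+ 2) ^ m * (F m + F (suc p)) ≡ 1ℤ ^ p + 0ℤ mod p × (+ 2) ^ m * F p ≡ 0ℤ + (+ 5) ^ k mod p
    coordinates = subst₂ _≈_ (1+√5-^ m) (cong₂ _⊕_ (integer-^ 1ℤ p) (√5-^-odd k))
                    (frobenius commutativeSemiring p-prime characteristic (1ℤ , 0ℤ) (0ℤ , 1ℤ))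
    without-2^m : ∀ {x y} → (+ 2) ^ m * x ≡ y mod p → x ≡ y mod p
    without-2^m {x} {y} 2^m*x≡y = begin
      x                ≡⟨ ℤₚ.*-identityˡ x ⟨
      1ℤ * x           ≈⟨ *-cong-mod (mod-sym (fermat-∸1 (prime∤prime prime[2] p≢2))) (≡⇒≡mod refl) ⟩
      (+ 2) ^ m * x    ≈⟨ 2^m*x≡y ⟩
      y                ∎

  -- ε = 5 ^ ((p − 1) / 2) is ±1 modulo p, and Lₚ = 2 Fₚ₋₁ + Fₚ ≡ 1 then determines Fₚ₋₁.
  period-of-prime : p ≢ 2 → p ≢ 5 → Period p (p Nat.∸ 1) ⊎ Period p (2 Nat.* suc p)
  period-of-prime p≢2 p≢5 with odd-prime p≢2
  ... | k , p≡2k+1@refl = cases (mod-square≡1 ε²≡1)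
    where
    open import Relation.Binary.Reasoning.Setoid (mod-setoid p)
    m = k Nat.+ k
    ε = (+ 5) ^ k
    ε²≡1 : ε * ε ≡ 1ℤ mod p
    ε²≡1 = mod-trans (≡⇒≡mod (sym (ℤₚ.^-distribˡ-+-* (+ 5) k k))) (fermat-∸1 (prime∤prime prime[5] p≢5))
    p∤2 : ¬ p ∣ℕ 2
    p∤2 = prime∤prime prime[2] p≢2
    F[p]≡ε : F p ≡ ε mod p
    F[p]≡ε = proj₂ (frobenius-1+√5 k p≡2k+1 p≢2)
    2F[p-1]≡1-ε : + 2 * F m ≡ 1ℤ - ε mod p
    2F[p-1]≡1-ε = begin
      + 2 * F m                  ≡⟨ double (F m) (F p) ⟩
      (F m + (F p + F m)) - F p  ≡⟨ cong (λ c → (F m + c) - F p) (F-rec m) ⟨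
      (F m + F (suc p)) - F p    ≈⟨ +-cong-mod (proj₁ (frobenius-1+√5 k p≡2k+1 p≢2)) (neg-cong-mod F[p]≡ε) ⟩
      1ℤ - ε                     ∎
      where
      double : ∀ a b → + 2 * a ≡ (a + (b + a)) - b
      double = solve-∀
    cases : ε ≡ 1ℤ mod p ⊎ ε ≡ - 1ℤ mod p → Period p m ⊎ Period p (2 Nat.* suc p)
    cases (inj₁ ε≡1) =
      inj₁ (mod-cancel p∤2 (mod-trans 2F[p-1]≡1-ε (+-cong-mod (≡⇒≡mod {y = 1ℤ} refl) (neg-cong-mod ε≡1))) ,
            mod-trans F[p]≡ε ε≡1)
    cases (inj₂ ε≡-1) = inj₂ (period-of-antiperiod F[p+1]≡0 F[p+2]≡-1)
      where
      F[p]≡-1 : F p ≡ - 1ℤ mod p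
      F[p]≡-1 = mod-trans F[p]≡ε ε≡-1
      F[p-1]≡1 : F m ≡ 1ℤ mod p
      F[p-1]≡1 = mod-cancel p∤2 (mod-trans 2F[p-1]≡1-ε (+-cong-mod (≡⇒≡mod {y = 1ℤ} refl) (neg-cong-mod ε≡-1)))
      F[p+1]≡0 : F (suc p) ≡ 0ℤ mod p
      F[p+1]≡0 = mod-trans (≡⇒≡mod (F-rec m)) (+-cong-mod F[p]≡-1 F[p-1]≡1)
      F[p+2]≡-1 : F (suc (suc p)) ≡ - 1ℤ mod p
      F[p+2]≡-1 = mod-trans (≡⇒≡mod (F-rec p)) (+-cong-mod F[p+1]≡0 F[p]≡-1)

-- The 5-adic valuation of Fibonacci numbers
module _ where
  open Int using (_+_; _*_; _-_; -_)
  open Nat using () renaming (_+_ to _+ℕ_; _*_ to _*ℕ_)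
  open import Data.Integer.Tactic.RingSolver using (solve-∀)

  -- equal to (−1) ^ n by Cassini's identity
  cassini : ℕ → ℤ
  cassini n = F (suc n) * F (suc n) - F (suc n) * F n - F n * F n

  cassini² : ∀ n → cassini n * cassini n ≡ 1ℤ
  cassini² zero    = refl
  cassini² (suc n) = trans (cong (λ c → c * c) cassini-suc) (trans (square-neg (cassini n)) (cassini² n))
    where
    a = F n
    b = F (suc n)
    cassini-suc : cassini (suc n) ≡ - cassini n
    cassini-suc = trans (cong (λ c → c * c - c * b - b * b) (F-rec n)) (flip a b)
      where
      flip : ∀ a b → (b + a) * (b + a) - (b + a) * b - b * b ≡ - (b * b - b * a - a * a)
      flip = solve-∀
    square-neg : ∀ c → (- c) * (- c) ≡ c * c
    square-neg = solve-∀

  quintuple-cofactor : ℕ → ℤ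
  quintuple-cofactor n = + 5 * (F n * F n * F n * F n + cassini n * (F n * F n)) + 1ℤ

  F[n*5] : ∀ n → F (n *ℕ 5) ≡ + 5 * (quintuple-cofactor n * F n)
  F[n*5] n = begin
    F (n *ℕ 5)
      ≡⟨ cong F (n*5≡n+4n n) ⟩
    F (n +ℕ (n +ℕ n +ℕ (n +ℕ n)))
      ≡⟨ proj₁ (F-+ (n +ℕ n +ℕ (n +ℕ n)) n) ⟩
    X₄ * b + Y₄ * a - X₄ * a
      ≡⟨ cong₂ (λ X Y → X * b + Y * a - X * a) (proj₁ (F-+ (n +ℕ n) (n +ℕ n))) (proj₂ (F-+ (n +ℕ n) (n +ℕ n))) ⟩
    (X₂ * Y₂ + Y₂ * X₂ - X₂ * X₂) * b + (Y₂ * Y₂ + X₂ * X₂) * a - (X₂ * Y₂ + Y₂ * X₂ - X₂ * X₂) * a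
      ≡⟨ trans (cong₂ (λ X Y → (X * Y + Y * X - X * X) * b + (Y * Y + X * X) * a - (X * Y + Y * X - X * X) * a)
                      (proj₁ (F-+ n n)) (proj₂ (F-+ n n)))
               (expand a b) ⟩
    a * (+ 25 * (a * a * a * a) + + 25 * s * (a * a) + + 5 * (s * s))
      ≡⟨ cong (λ z → a * (+ 25 * (a * a * a * a) + + 25 * s * (a * a) + + 5 * z)) (cassini² n) ⟩
    a * (+ 25 * (a * a * a * a) + + 25 * s * (a * a) + + 5 * 1ℤ)
      ≡⟨ regroup a s ⟩
    + 5 * (quintuple-cofactor n * a) ∎
    where
    open ≡-Reasoning
    open import Data.Nat.Tactic.RingSolver using () renaming (solve-∀ to solveℕ-∀)
    a = F n
    b = F (suc n)
    s = cassini n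
    X₂ = F (n +ℕ n)
    Y₂ = F (suc (n +ℕ n))
    X₄ = F (n +ℕ n +ℕ (n +ℕ n))
    Y₄ = F (suc (n +ℕ n +ℕ (n +ℕ n)))
    n*5≡n+4n : ∀ n → n *ℕ 5 ≡ n +ℕ (n +ℕ n +ℕ (n +ℕ n))
    n*5≡n+4n = solveℕ-∀
    expand : ∀ a b →
      ((a * b + b * a - a * a) * (b * b + a * a) + (b * b + a * a) * (a * b + b * a - a * a) - (a * b + b * a - a * a) * (a * b + b * a - a * a)) * b
      + ((b * b + a * a) * (b * b + a * a) + (a * b + b * a - a * a) * (a * b + b * a - a * a)) * a
      - ((a * b + b * a - a * a) * (b * b + a * a) + (b * b + a * a) * (a * b + b * a - a * a) - (a * b + b * a - a * a) * (a * b + b * a - a * a)) * a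
      ≡ a * (+ 25 * (a * a * a * a) + + 25 * (b * b - b * a - a * a) * (a * a) + + 5 * ((b * b - b * a - a * a) * (b * b - b * a - a * a)))
    expand = solve-∀
    regroup : ∀ a s → a * (+ 25 * (a * a * a * a) + + 25 * s * (a * a) + + 5 * 1ℤ)
                      ≡ + 5 * ((+ 5 * (a * a * a * a + s * (a * a)) + 1ℤ) * a)
    regroup = solve-∀

module _ where
  open Nat using (_+_; _*_; _^_)
  open import Data.Nat.Coprimality using (coprime-divisor)
  open import Relation.Nullary.Decidable using (_→-dec_)

  period⇒∣fib : ∀ {m k} → Period m k → m ∣ℕ fib k
  period⇒∣fib (mkMod m∣F , _) = subst (_ ∣ℕ_) (ℕₚ.+-identityʳ _) (ℤ∣.∣⇒∣ᵤ m∣F)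

  -- F modulo 5 has period 20, and F r with r < 20 is divisible by 5 only for 5 ∣ r.
  5∣fib⇒5∣ : ∀ k → 5 ∣ℕ fib k → 5 ∣ℕ k
  5∣fib⇒5∣ k 5∣F[k] =
    subst (5 ∣ℕ_) k≡r+q*20 (ℕ∣.∣m∣n⇒∣m+n (below-20 r<20 5∣F[r]) (ℕ∣.∣-trans (divides 4 refl) (ℕ∣.n∣m*n q)))
    where
    r = k Nat.% 20
    q = k Nat./ 20
    r<20 : r < 20
    r<20 = m%n<n k 20
    k≡r+q*20 : r + q * 20 ≡ k
    k≡r+q*20 = sym (m≡m%n+[m/n]*n k 20)
    F[k]≡F[r] : + fib k ≡ + fib r mod 5
    F[k]≡F[r] = subst (λ n → + fib n ≡ + fib r mod 5) k≡r+q*20 (proj₁ (period-shift (period-* q (pisano-period 5)) r))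
    5∣F[r] : 5 ∣ℕ fib r
    5∣F[r] = ℕ∣.m%n≡0⇒n∣m _ 5 (trans (sym (mod⇒%≡ F[k]≡F[r])) (ℕ∣.n∣m⇒m%n≡0 _ 5 5∣F[k]))
    below-20 : ∀ {n} → n < 20 → 5 ∣ℕ fib n → 5 ∣ℕ n
    below-20 = from-yes (ℕₚ.allUpTo? (λ n → (5 ℕ∣.∣? fib n) →-dec (5 ℕ∣.∣? n)) 20)

  5∤quintuple-cofactor : ∀ n → ¬ 5 ∣ℕ Int.∣ quintuple-cofactor n ∣
  5∤quintuple-cofactor n 5∣U = 5≢1 (ℕ∣.∣1⇒≡1 (ℤ∣.∣⇒∣ᵤ 5∣1))
    where
    W = F n Int.* F n Int.* F n Int.* F n Int.+ cassini n Int.* (F n Int.* F n)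
    5∣1 : + 5 ℤ∣.∣ 1ℤ
    5∣1 = ℤ∣.∣m+n∣m⇒∣n {m = + 5 Int.* W} (ℤ∣.∣ᵤ⇒∣ 5∣U) (ℤ∣.∣m⇒∣m*n W (ℤ∣.∣-refl {+ 5}))
    5≢1 : 5 ≢ 1
    5≢1 ()

  5^∣fib⇒5^∣ : ∀ c k → 5 ^ c ∣ℕ fib k → 5 ^ c ∣ℕ k
  5^∣fib⇒5^∣ zero    k _          = ℕ∣.1∣ k
  5^∣fib⇒5^∣ (suc c) k 5^[c+1]∣F =
    multiple-of-5 (5∣fib⇒5∣ k (ℕ∣.∣-trans (ℕ∣.m∣m*n (5 ^ c)) 5^[c+1]∣F)) 5^[c+1]∣F
    where
    multiple-of-5 : ∀ {k} → 5 ∣ℕ k → 5 ^ suc c ∣ℕ fib k → 5 ^ suc c ∣ℕ k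
    multiple-of-5 (divides n refl) 5^[c+1]∣F[5n] =
      subst (5 ^ suc c ∣ℕ_) (ℕₚ.*-comm 5 n) (ℕ∣.*-monoʳ-∣ 5 (5^∣fib⇒5^∣ c n 5^c∣F[n]))
      where
      U = quintuple-cofactor n
      fib[n*5] : fib (n * 5) ≡ 5 * (Int.∣ U ∣ * fib n)
      fib[n*5] = trans (cong Int.∣_∣ (F[n*5] n)) (trans (ℤₚ.abs-* (+ 5) (U Int.* F n)) (cong (5 *_) (ℤₚ.abs-* U (F n))))
      5^c∣F[n] : 5 ^ c ∣ℕ fib n
      5^c∣F[n] = coprime-divisor (prime^-coprime prime[5] (5∤quintuple-cofactor n) c)
                   (ℕ∣.*-cancelˡ-∣ 5 (subst (5 ^ suc c ∣ℕ_) fib[n*5] 5^[c+1]∣F[5n]))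

-- Iterating π
module _ where
  open Nat using (_+_; _*_; _^_; _⊔_)
  open import Data.Nat.GCD using (gcd; gcd[m,n]∣n)

  -- Unlike IsFixed this admits the fixed point 1, which makes it closed under lcm.
  record FixedAfter (j m : ℕ) : Set where
    constructor fixed-after
    field
      iterate-fixed : pisano (pisanoIter j m) ≡ pisanoIter j m

  fixed-after-suc : ∀ {j m} → FixedAfter j m → FixedAfter (suc j) m
  fixed-after-suc (fixed-after fixed) = fixed-after (cong pisano fixed)

  fixed-after-≤ : ∀ {j k m} → j ≤ k → FixedAfter j m → FixedAfter k m
  fixed-after-≤ {j} {k} {m} j≤k fixed =
    subst (λ i → FixedAfter i m) (ℕₚ.m∸n+n≡m j≤k) (iterate (k Nat.∸ j))
    where
    iterate : ∀ d → FixedAfter (d + j) m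
    iterate zero    = fixed
    iterate (suc d) = fixed-after-suc (iterate d)

  fixed-after-1 : ∀ j → FixedAfter j 1
  fixed-after-1 j = fixed-after (trans (cong pisano (iterate-1 j)) (sym (iterate-1 j)))
    where
    iterate-1 : ∀ j → pisanoIter j 1 ≡ 1
    iterate-1 zero    = refl
    iterate-1 (suc j) = cong pisano (iterate-1 j)

  fixed-after-pisano : ∀ {j m} → FixedAfter j (pisano m) → FixedAfter (suc j) m
  fixed-after-pisano {j} {m} (fixed-after fixed) =
    fixed-after (subst (λ x → pisano x ≡ x) (sym (iterate-pisano j)) fixed)
    where
    iterate-pisano : ∀ j → pisanoIter (suc j) m ≡ pisanoIter j (pisano m)
    iterate-pisano zero    = refl
    iterate-pisano (suc j) = cong pisano (iterate-pisano j)

  pisanoIter-lcm : ∀ j a b → pisanoIter j (lcm a b) ≡ lcm (pisanoIter j a) (pisanoIter j b)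
  pisanoIter-lcm zero    a b = refl
  pisanoIter-lcm (suc j) a b =
    trans (cong pisano (pisanoIter-lcm j a b)) (pisano-lcm (pisanoIter j a) (pisanoIter j b))

  fixed-after-lcm : ∀ {j a b} → FixedAfter j a → FixedAfter j b → FixedAfter j (lcm a b)
  fixed-after-lcm {j} {a} {b} (fixed-after fixed-a) (fixed-after fixed-b) = fixed-after
    (subst (λ x → pisano x ≡ x) (sym (pisanoIter-lcm j a b))
           (trans (pisano-lcm (pisanoIter j a) (pisanoIter j b)) (cong₂ lcm fixed-a fixed-b)))

  fixed-after-∣3 : ∀ {d} → d ∣ℕ 3 → FixedAfter 3 d
  fixed-after-∣3 d∣3 with prime⇒irreducible prime[3] d∣3
  ... | inj₁ refl = fixed-after-1 3
  ... | inj₂ refl = fixed-after refl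

  fixed-after-∣2^ : ∀ g {d} → d ∣ℕ 2 ^ g → FixedAfter (g + 4) d
  fixed-after-∣2^ zero    d∣1 rewrite ℕ∣.∣1⇒≡1 d∣1 = fixed-after-1 4
  fixed-after-∣2^ (suc g) {d} d∣2^[g+1] =
    fixed-after-pisano {g + 4} {d} (subst (FixedAfter (g + 4)) (sym π≡lcm)
      (fixed-after-lcm (fixed-after-∣2^ g (gcd[m,n]∣n (pisano d) (2 ^ g)))
                       (fixed-after-≤ 3≤g+4 (fixed-after-∣3 (gcd[m,n]∣n (pisano d) 3)))))
    where
    3≤g+4 : 3 ≤ g + 4
    3≤g+4 = ℕₚ.≤-trans (ℕₚ.m≤n+m 3 1) (ℕₚ.m≤n+m 4 g)
    π∣2^g*3 : pisano d ∣ℕ 2 ^ g * 3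
    π∣2^g*3 = ℕ∣.∣-trans (pisano-∣-mono d∣2^[g+1]) (period⇒pisano∣ (period-pow (pisano-period 2) g))
    π≡lcm : pisano d ≡ lcm (gcd (pisano d) (2 ^ g)) (gcd (pisano d) 3)
    π≡lcm = ∣coprime-*⇒≡lcm-gcd (prime^-coprime prime[2] (from-no (2 ℕ∣.∣? 3)) g) π∣2^g*3

  pisano-5^ : ∀ e → pisano (5 ^ suc e) ≡ lcm 4 (5 ^ suc e)
  pisano-5^ e = ℕ∣.∣-antisym π∣lcm (lcm-least 4∣π x∣π)
    where
    x = 5 ^ suc e
    4*x≡lcm : 5 ^ e * 20 ≡ lcm 4 x
    4*x≡lcm = trans (regroup (5 ^ e))
                    (sym (coprime⇒lcm≡* (Coprimality.sym (prime^-coprime prime[5] (from-no (5 ℕ∣.∣? 4)) (suc e)))))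
      where
      open import Data.Nat.Tactic.RingSolver using (solve-∀)
      regroup : ∀ t → t * 20 ≡ 4 * (5 * t)
      regroup = solve-∀
    π∣lcm : pisano x ∣ℕ lcm 4 x
    π∣lcm = subst (pisano x ∣ℕ_) 4*x≡lcm (period⇒pisano∣ (period-pow (pisano-period 5) e))
    4∣π : 4 ∣ℕ pisano x
    4∣π = ℕ∣.∣-trans (divides 5 refl) (pisano-∣-mono {5} (ℕ∣.m∣m*n (5 ^ e)))
    x∣π : x ∣ℕ pisano x
    x∣π = 5^∣fib⇒5^∣ (suc e) (pisano x) (period⇒∣fib (pisano-period x))

  -- π (lcm c x) = lcm (lcm (π c) 4) x, and c runs through 4, 12, 24, 24.
  fixed-after-5^ : ∀ e → FixedAfter 3 (5 ^ suc e)
  fixed-after-5^ e = fixed-after (subst (λ y → pisano y ≡ y) (sym iterate-3) (step 24))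
    where
    open ≡-Reasoning
    x = 5 ^ suc e
    step : ∀ c → pisano (lcm c x) ≡ lcm (lcm (pisano c) 4) x
    step c = trans (pisano-lcm c x) (trans (cong (lcm (pisano c)) (pisano-5^ e)) (sym (lcm-assoc (pisano c) 4 x)))
    iterate-3 : pisano (pisano (pisano x)) ≡ lcm 24 x
    iterate-3 = begin
      pisano (pisano (pisano x))  ≡⟨ cong (λ y → pisano (pisano y)) (pisano-5^ e) ⟩
      pisano (pisano (lcm 4 x))   ≡⟨ cong pisano (step 4) ⟩
      pisano (lcm 12 x)           ≡⟨ step 12 ⟩
      lcm 24 x                    ∎

  FixedWithin : ℕ → ℕ → Set
  FixedWithin B m = ∃ λ j → FixedAfter j m × 2 ^ j ≤ B

  within-mono : ∀ {B B′ m} → B ≤ B′ → FixedWithin B m → FixedWithin B′ m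
  within-mono B≤B′ (j , fixed , 2^j≤B) = j , fixed , ℕₚ.≤-trans 2^j≤B B≤B′

  within-lcm : ∀ {B a b} → FixedWithin B a → FixedWithin B b → FixedWithin B (lcm a b)
  within-lcm {B} (j , fixed-a , 2^j≤B) (k , fixed-b , 2^k≤B) =
    j ⊔ k , fixed-after-lcm (fixed-after-≤ (ℕₚ.m≤m⊔n j k) fixed-a) (fixed-after-≤ (ℕₚ.m≤n⊔m j k) fixed-b) , 2^[j⊔k]≤B
    where
    2^[j⊔k]≤B : 2 ^ (j ⊔ k) ≤ B
    2^[j⊔k]≤B with ℕₚ.⊔-sel j k
    ... | inj₁ j⊔k≡j = subst (λ i → 2 ^ i ≤ B) (sym j⊔k≡j) 2^j≤B
    ... | inj₂ j⊔k≡k = subst (λ i → 2 ^ i ≤ B) (sym j⊔k≡k) 2^k≤B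

  within-pisano : ∀ {B m} → FixedWithin B (pisano m) → FixedWithin (2 * B) m
  within-pisano (j , fixed , 2^j≤B) = suc j , fixed-after-pisano fixed , ℕₚ.*-monoʳ-≤ 2 2^j≤B

  within-∣2^ : ∀ g {d} → d ∣ℕ 2 ^ g → FixedWithin (16 * 2 ^ g) d
  within-∣2^ g d∣2^g =
    g + 4 , fixed-after-∣2^ g d∣2^g , ℕₚ.≤-reflexive (trans (ℕₚ.^-distribˡ-+-* 2 g 4) (ℕₚ.*-comm (2 ^ g) 16))

-- Every trajectory is fixed within a logarithmic number of steps
module _ where
  open Nat using (_+_; _*_; _^_)
  open import Data.Nat.Coprimality using (coprime-divisor)
  open import Data.Nat.GCD using (gcd; gcd[m,n]∣n)
  open import Data.Nat.Induction using (<-rec)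
  open import Data.Nat.Tactic.RingSolver using (solve-∀)

  -- For p = 2k + 1: p − 1 = 2k divides 4k, and 2 (p + 1) = 4 (k + 1).
  small-period : ∀ {p} → Prime p → p ≢ 2 → p ≢ 5 → ∃ λ c → 1 ≤ c × 2 * c ≤ suc p × Period p (4 * c)
  small-period {p} p-prime p≢2 p≢5 with odd-prime p-prime p≢2 | period-of-prime p-prime p≢2 p≢5
  ... | zero  , refl | _ = ⊥-elim (¬prime[1] p-prime)
  ... | suc k , refl | inj₁ period-p-1 =
    suc k , s≤s z≤n , ℕₚ.≤-trans (ℕₚ.≤-reflexive (double (suc k))) (ℕₚ.≤-trans (ℕₚ.n≤1+n _) (ℕₚ.n≤1+n _)) ,
    subst (Period p) (quadruple (suc k)) (period-* 2 period-p-1)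
    where
    double : ∀ k → 2 * k ≡ k + k
    double = solve-∀
    quadruple : ∀ k → 2 * (k + k) ≡ 4 * k
    quadruple = solve-∀
  ... | suc k , refl | inj₂ period-2[p+1] =
    suc (suc k) , s≤s z≤n , ℕₚ.≤-reflexive (double k) , subst (Period p) (quadruple k) period-2[p+1]
    where
    double : ∀ k → 2 * (2 + k) ≡ 2 + (suc k + suc k)
    double = solve-∀
    quadruple : ∀ k → 2 * (2 + (suc k + suc k)) ≡ 4 * (2 + k)
    quadruple = solve-∀

  odd-prime∤4* : ∀ {p c} → Prime p → p ≢ 2 → 1 ≤ c → c < p → ¬ p ∣ℕ 4 * c
  odd-prime∤4* {c = c} p-prime p≢2 1≤c c<p p∣4c with euclidsLemma 4 c p-prime p∣4c
  ... | inj₂ p∣c = ℕₚ.<⇒≱ c<p (ℕ∣.∣⇒≤ {{Nat.>-nonZero 1≤c}} p∣c)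
  ... | inj₁ p∣4 = prime∤prime p-prime prime[2] p≢2 (reduce (euclidsLemma 2 2 p-prime p∣4))

  -- w = 2 ^ a · b with b odd, so b ∣ c and 2 ^ a ≤ 4c.
  within-∣4* : ∀ {c M} → 1 ≤ c → (∀ {k} → k ≤ c → 1 ≤ k → FixedWithin (64 * (k * k)) k) →
               64 * c ≤ M → 64 * (c * c) ≤ M → ∀ {w} → 1 ≤ w → w ∣ℕ 4 * c → FixedWithin M w
  within-∣4* {c} {M} 1≤c small 64c≤M 64c²≤M {w} 1≤w w∣4c with factor-out prime[2] w 1≤w
  ... | a , zero , _ , 2∤0 = ⊥-elim (2∤0 (2 ℕ∣.∣0))
  ... | a , b@(suc _) , w≡2^a*b , 2∤b =
    subst (FixedWithin M) (trans (coprime⇒lcm≡* (prime^-coprime prime[2] 2∤b a)) (sym w≡2^a*b))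
          (within-lcm (within-mono 16*2^a≤M (within-∣2^ a ℕ∣.∣-refl)) (within-mono 64b²≤M (small b≤c (s≤s z≤n))))
    where
    instance
      c≢0 : NonZero c
      c≢0 = Nat.>-nonZero 1≤c
      4c≢0 : NonZero (4 * c)
      4c≢0 = ℕₚ.m*n≢0 4 c
    2^a∣4c : 2 ^ a ∣ℕ 4 * c
    2^a∣4c = ℕ∣.∣-trans (divides b (trans w≡2^a*b (ℕₚ.*-comm (2 ^ a) b))) w∣4c
    b≤c : b ≤ c
    b≤c = ℕ∣.∣⇒≤ (coprime-divisor (Coprimality.sym (prime^-coprime prime[2] 2∤b 2))
                                  (ℕ∣.∣-trans (divides (2 ^ a) w≡2^a*b) w∣4c))
    16*2^a≤M : 16 * 2 ^ a ≤ M
    16*2^a≤M = ℕₚ.≤-trans (ℕₚ.*-monoʳ-≤ 16 (ℕ∣.∣⇒≤ 2^a∣4c))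
                          (ℕₚ.≤-trans (ℕₚ.≤-reflexive (sym (ℕₚ.*-assoc 16 4 c))) 64c≤M)
    64b²≤M : 64 * (b * b) ≤ M
    64b²≤M = ℕₚ.≤-trans (ℕₚ.*-monoʳ-≤ 64 (square-mono b≤c)) 64c²≤M

  within-prime^ : ∀ {p} → Prime p → p ≢ 2 → p ≢ 5 → ∀ e →
    (∀ {k} → k < p ^ suc e → 1 ≤ k → FixedWithin (64 * (k * k)) k) →
    FixedWithin (64 * (p ^ suc e * p ^ suc e)) (p ^ suc e)
  within-prime^ {p} p-prime p≢2 p≢5 e below with small-period p-prime p≢2 p≢5
  ... | c , 1≤c , 2c≤p+1 , period-4c =
    subst (λ B → FixedWithin B m) (sym (ℕₚ.*-assoc 2 32 (m * m)))
          (within-pisano (subst (FixedWithin _) (sym y≡lcm)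
            (within-lcm (within-mono (halve (u * u) 2u²≤m²) (below (ℕₚ.≤-<-trans u≤t t<m) (gcd-positive t 1≤y)))
                        (within-∣4* 1≤c (λ k≤c → below (ℕₚ.≤-<-trans k≤c c<m)) (halve c 2c≤m²) (halve (c * c) 2c²≤m²)
                                    (gcd-positive (4 * c) 1≤y) (gcd[m,n]∣n y (4 * c))))))
    where
    m = p ^ suc e
    t = p ^ e
    y = pisano m
    u = gcd y t
    instance
      p≢0 : NonZero p
      p≢0 = prime⇒nonZero p-prime
      t≢0 : NonZero t
      t≢0 = ℕₚ.m^n≢0 p e
    2≤p : 2 ≤ p
    2≤p = prime>1 p-prime
    1≤y : 1 ≤ y
    1≤y = pisano-positive (ℕₚ.m^n>0 p (suc e))
    t<m : t < m
    t<m = subst (t <_) (ℕₚ.*-comm t p) (ℕₚ.m<m*n t p 2≤p)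
    p≤m : p ≤ m
    p≤m = ℕₚ.m≤m*n p t
    c<p : c < p
    c<p = 2c≤1+p⇒c<p 2≤p 2c≤p+1
    c<m : c < m
    c<m = ℕₚ.<-≤-trans c<p p≤m
    y≡lcm : y ≡ lcm u (gcd y (4 * c))
    y≡lcm = ∣coprime-*⇒≡lcm-gcd (prime^-coprime p-prime (odd-prime∤4* p-prime p≢2 1≤c c<p) e)
                                (period⇒pisano∣ (period-pow period-4c e))
    u≤t : u ≤ t
    u≤t = ℕ∣.∣⇒≤ (gcd[m,n]∣n y t)
    p²≤m² : p * p ≤ m * m
    p²≤m² = square-mono p≤m
    halve : ∀ x → 2 * x ≤ m * m → 64 * x ≤ 32 * (m * m)
    halve x 2x≤m² = ℕₚ.≤-trans (ℕₚ.≤-reflexive (ℕₚ.*-assoc 32 2 x)) (ℕₚ.*-monoʳ-≤ 32 2x≤m²)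
    2u²≤m² : 2 * (u * u) ≤ m * m
    2u²≤m² = u≤t⇒2u²≤[pt]² u≤t 2≤p
    2c≤m² : 2 * c ≤ m * m
    2c≤m² = ℕₚ.≤-trans 2c≤p+1 (ℕₚ.≤-trans (1+p≤p*p 2≤p) p²≤m²)
    2c²≤m² : 2 * (c * c) ≤ m * m
    2c²≤m² = ℕₚ.≤-trans (2c≤1+p⇒2c²≤p² {c} (odd-prime-≥3 p-prime p≢2) 2c≤p+1) p²≤m²

  within-prime-power : ∀ {p} → Prime p → ∀ e →
    (∀ {k} → k < p ^ suc e → 1 ≤ k → FixedWithin (64 * (k * k)) k) →
    FixedWithin (64 * (p ^ suc e * p ^ suc e)) (p ^ suc e)
  within-prime-power {p} p-prime e below with p Nat.≟ 2 | p Nat.≟ 5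
  ... | yes refl | _        = within-mono 16q≤64q² (within-∣2^ (suc e) ℕ∣.∣-refl)
    where
    1≤q = ℕₚ.m^n>0 2 (suc e)
    16q≤64q² : 16 * 2 ^ suc e ≤ 64 * (2 ^ suc e * 2 ^ suc e)
    16q≤64q² = ℕₚ.*-mono-≤ (ℕₚ.m≤m+n 16 48) (ℕₚ.m≤m*n (2 ^ suc e) (2 ^ suc e) {{ℕₚ.m^n≢0 2 (suc e)}})
  ... | no _     | yes refl = 3 , fixed-after-5^ e , ℕₚ.*-mono-≤ (ℕₚ.m≤m+n 8 56) (ℕₚ.*-mono-≤ 1≤q 1≤q)
    where
    1≤q = ℕₚ.m^n>0 5 (suc e)
  ... | no p≢2   | no p≢5   = within-prime^ p-prime p≢2 p≢5 e below

  within-64m² : ∀ m → 1 ≤ m → FixedWithin (64 * (m * m)) m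
  within-64m² = <-rec _ step
    where
    step : ∀ m → (∀ {k} → k < m → 1 ≤ k → FixedWithin (64 * (k * k)) k) → 1 ≤ m → FixedWithin (64 * (m * m)) m
    step (suc zero)      _     _   = 0 , fixed-after-1 0 , s≤s z≤n
    step m@(suc (suc _)) below 1≤m with prime-divisor {m} (s≤s (s≤s z≤n))
    ... | p , p-prime , p∣m with factor-out p-prime m 1≤m
    ...   | zero  , r , m≡r , p∤r = ⊥-elim (p∤r (subst (p ∣ℕ_) (trans m≡r (ℕₚ.+-identityʳ r)) p∣m))
    ...   | suc e , zero , m≡0 , _ = ⊥-elim (ℕₚ.<⇒≢ 1≤m (sym (trans m≡0 (ℕₚ.*-zeroʳ (p ^ suc e)))))
    ...   | suc e , r@(suc _) , m≡q*r , p∤r =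
      subst (FixedWithin _) (trans (coprime⇒lcm≡* (prime^-coprime p-prime p∤r (suc e))) (sym m≡q*r))
        (within-lcm (within-mono (bound q≤m) (within-prime-power p-prime e (λ k<q → below (ℕₚ.<-≤-trans k<q q≤m))))
                    (within-mono (bound r≤m) (below r<m (s≤s z≤n))))
      where
      q = p ^ suc e
      instance
        q≢0 : NonZero q
        q≢0 = ℕₚ.m^n≢0 p (suc e) {{prime⇒nonZero p-prime}}
      2≤q : 2 ≤ q
      2≤q = ℕₚ.≤-trans (prime>1 p-prime) (ℕₚ.m≤m*n p (p ^ e) {{ℕₚ.m^n≢0 p e {{prime⇒nonZero p-prime}}}})
      q≤m : q ≤ m
      q≤m = subst (q ≤_) (sym m≡q*r) (ℕₚ.m≤m*n q r)
      r<m : r < m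
      r<m = subst (r <_) (trans (ℕₚ.*-comm r q) (sym m≡q*r)) (ℕₚ.m<m*n r q 2≤q)
      r≤m = ℕₚ.<⇒≤ r<m
      bound : ∀ {k} → k ≤ m → 64 * (k * k) ≤ 64 * (m * m)
      bound k≤m = ℕₚ.*-monoʳ-≤ 64 (square-mono k≤m)

-- The first fixed point of a trajectory
module _ where
  open Nat using (_+_; _*_; _^_; _<?_; _≟_)
  open import Data.Nat.Logarithm using (⌊log₂_⌋; ⌊log₂⌋-mono-≤; ⌊log₂[2^n]⌋≡n)
  open import Data.Nat.Tactic.RingSolver using (solve-∀)
  open import Relation.Nullary using (Dec)
  open import Relation.Nullary.Decidable using (_×-dec_)

  least-index : ∀ {P : ℕ → Set} → (∀ n → Dec (P n)) → ∀ j → P j →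
                ∃ λ i → i ≤ j × P i × (∀ k → k < i → ¬ P k)
  least-index P? zero    P0 = 0 , z≤n , P0 , λ _ ()
  least-index P? (suc j) Pj+1 with P? 0
  ... | yes P0 = 0 , z≤n , P0 , λ _ ()
  ... | no ¬P0 with least-index (P? ∘ suc) j Pj+1
  ...   | i , i≤j , Pi+1 , below = suc i , s≤s i≤j , Pi+1 , λ { zero _ → ¬P0 ; (suc k) (s≤s k<i) → below k k<i }

  iterate-≥2 : ∀ j {m} → 2 ≤ m → 2 ≤ pisanoIter j m
  iterate-≥2 zero    2≤m = 2≤m
  iterate-≥2 (suc j) 2≤m = pisano-≥2 (iterate-≥2 j 2≤m)

  first-fixed-index : ∀ {j m} → 2 ≤ m → FixedAfter j m → ∃ λ i → i ≤ j × IsT m i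
  first-fixed-index {j} {m} 2≤m (fixed-after fixed) =
    least-index (λ i → isFixed? (pisanoIter i m)) j (iterate-≥2 j 2≤m , fixed)
    where
    isFixed? : ∀ x → Dec (IsFixed x)
    isFixed? x = (1 <? x) ×-dec (pisano x ≟ x)

  log-bound : ∀ {m j} → 2 ≤ m → 2 ^ j ≤ 64 * (m * m) → j ≤ 10 * ⌊log₂ m ⌋
  log-bound {m} {j} 2≤m 2^j≤64m² = ℕₚ.≮⇒≥ λ 10L<j →
    ℕₚ.<-irrefl refl (subst (_≤ L) (⌊log₂[2^n]⌋≡n (suc L)) (⌊log₂⌋-mono-≤ (2^[L+1]≤m 10L<j)))
    where
    L = ⌊log₂ m ⌋
    2^[L+1]≤m : 10 * L < j → 2 ^ suc L ≤ m
    2^[L+1]≤m 10L<j = ℕₚ.≮⇒≥ λ m<2^[L+1] → ℕₚ.<-irrefl refl (begin-strict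
      64 * (m * m)                  <⟨ ℕₚ.*-monoʳ-< 64 (ℕₚ.*-mono-< m<2^[L+1] m<2^[L+1]) ⟩
      64 * (2 ^ suc L * 2 ^ suc L)  ≡⟨ cong (64 *_) (ℕₚ.^-distribˡ-+-* 2 (suc L) (suc L)) ⟨
      64 * 2 ^ (suc L + suc L)      ≡⟨ ℕₚ.^-distribˡ-+-* 2 6 (suc L + suc L) ⟨
      2 ^ (6 + (suc L + suc L))     ≡⟨ cong (2 ^_) (exponent L) ⟩
      2 ^ (2 * L + 8)               ≤⟨ ℕₚ.^-monoʳ-≤ 2 2L+8≤j ⟩
      2 ^ j                         ≤⟨ 2^j≤64m² ⟩
      64 * (m * m)                  ∎)
      where
      open ℕₚ.≤-Reasoning
      exponent : ∀ L → 6 + (suc L + suc L) ≡ 2 * L + 8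
      exponent = solve-∀
      tenfold : ∀ L → 2 * L + 8 * L ≡ 10 * L
      tenfold = solve-∀
      2L+8≤j : 2 * L + 8 ≤ j
      2L+8≤j = ℕₚ.<⇒≤ (begin-strict
        2 * L + 8      ≤⟨ ℕₚ.+-monoʳ-≤ (2 * L) (ℕₚ.*-monoʳ-≤ 8 (⌊log₂⌋-mono-≤ 2≤m)) ⟩
        2 * L + 8 * L  ≡⟨ tenfold L ⟩
        10 * L         <⟨ 10L<j ⟩
        j              ∎)

open import Data.Nat using (_*_)
open import Data.Nat.Logarithm using (⌊log₂_⌋)

theorem1p3 : ∃ λ (C : ℕ) → ∃ λ (N : ℕ) → ∀ (m : ℕ) → 2 ≤ m → N ≤ m →
    Σ ℕ λ j → IsT m j × j ≤ C * ⌊log₂ m ⌋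
theorem1p3 = 10 , 2 , λ m 2≤m _ → first-index m 2≤m (within-64m² m (ℕₚ.<⇒≤ 2≤m))
  where
  first-index : ∀ m → 2 ≤ m → FixedWithin (64 * (m * m)) m → Σ ℕ λ j → IsT m j × j ≤ 10 * ⌊log₂ m ⌋
  first-index m 2≤m (j , fixed , 2^j≤64m²) with first-fixed-index 2≤m fixed
  ... | i , i≤j , isT = i , isT , ℕₚ.≤-trans i≤j (log-bound 2≤m 2^j≤64m²)
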